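{- Let $q$ be a prime power, $m\ge 1$, and let $t$ be an integer with $0\le t\le m-1$. Let $Q_t=\{c\in(\mathbb{F}_q)^m\mid \mathrm{w}(c)\le t\}$. Then the vanishing ideal of $Q_t$ in $\mathbb{F}_q[y_1,\dots,y_m]$ satisfies $$\mathcal{I}(Q_t)=\langle\{\sigma_{t+1},\dots,\sigma_m\}\cup E_q[Y]\rangle ,$$ and hence the reduced Gröbner basis $G$ of $\mathcal{I}(Q_t)$ (with respect to any admissible term order) is $G=E_q[Y]\cup\mathcal{M}_{m,t+1}$ if $t\ge1$, and $G=\{y_1,\dots,y_m\}$ if $t=0$.
   Context: $\mathbb{F}_q$ is the finite field with $q$ elements; $\mathrm{w}(c)$ is the Hamming weight (number of nonzero coordinates) of $c$. For $S\subseteq(\mathbb{F}_q)^m$, $\mathcal{I}(S)$ is the ideal of all $f\in\mathbb{F}_q[y_1,\dots,y_m]$ vanishing at every point of $S$. $E_q[Y]=\{y_1^q-y_1,\dots,y_m^q-y_m\}$. For $1\le s\le m$, $\mathcal{M}_{m,s}=\{y_{h_1}\cdots y_{h_s}\mid 1\le h_1<\dots<h_s\le m\}$. $\sigma_i$ denotes the $i$-th elementary symmetric polynomial in $y_1,\dots,y_m$. -}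

module Defs where

open import Level using (0ℓ)
open import Algebra.Bundles using (CommutativeRing)
open import Data.Nat as ℕ using (ℕ; zero; suc)
open import Data.Nat.Primality using (Prime)
open import Data.Bool using (Bool; true; false)
open import Data.Fin using (Fin)
open import Data.Vec as Vec using (Vec; []; _∷_; lookup; zipWith; replicate; count)
import Data.Vec.Properties as VecP
open import Data.List as List using (List; []; _∷_; _++_; concatMap; filter; foldr; length)
open import Data.Product using (Σ; ∃; ∃-syntax; _×_; _,_)
open import Relation.Binary.PropositionalEquality using (_≡_; _≢_)
open import Relation.Binary.Definitions using (Decidable)
open import Relation.Binary.Structures using (IsStrictTotalOrder)
open import Induction.WellFounded using (WellFounded)
open import Relation.Nullary using (¬_; yes; no; ¬?)
open import Function.Bundles using (_⇔_)

IsPrimePower : ℕ → Set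
IsPrimePower q = ∃[ p ] ∃[ k ] (Prime p × q ≡ p ℕ.^ suc k)

record FiniteField (q : ℕ) : Set₁ where
  field
    commRing : CommutativeRing 0ℓ 0ℓ
  open CommutativeRing commRing public
  field
    _≟_       : Decidable _≈_
    0≉1       : ¬ (0# ≈ 1#)
    inverse   : ∀ x → ¬ (x ≈ 0#) → ∃[ y ] (x * y ≈ 1#)
    enum      : Fin q → Carrier
    enum-inj  : ∀ i j → enum i ≈ enum j → i ≡ j
    enum-surj : ∀ x → ∃[ i ] (enum i ≈ x)

Mon : ℕ → Set
Mon m = Vec ℕ m

_+ᵐ_ : ∀ {m} → Mon m → Mon m → Mon m
_+ᵐ_ = zipWith ℕ._+_

0ᵐ : ∀ {m} → Mon m
0ᵐ = replicate _ 0

_∣ᵐ_ : ∀ {m} → Mon m → Mon m → Set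
_∣ᵐ_ {m} α β = ∀ (i : Fin m) → lookup α i ℕ.≤ lookup β i

record TermOrder (m : ℕ) : Set₁ where
  field
    _<_      : Mon m → Mon m → Set
    isSTO    : IsStrictTotalOrder _≡_ _<_
    mono     : ∀ α β γ → α < β → (α +ᵐ γ) < (β +ᵐ γ)
    wf       : WellFounded _<_
  _≤_ : Mon m → Mon m → Set
  α ≤ β = α < β Data.Sum.⊎ α ≡ β
    where import Data.Sum

allBools : (n : ℕ) → List (Vec Bool n)
allBools zero    = [] ∷ []
allBools (suc n) = concatMap (λ v → (true ∷ v) ∷ (false ∷ v) ∷ []) (allBools n)

boolToℕ : Bool → ℕ
boolToℕ true  = 1
boolToℕ false = 0

module Polynomials {q : ℕ} (F : FiniteField q) (m : ℕ) where
  open FiniteField F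

  -- a polynomial in F[y_1..y_m] is a finite formal sum of terms c·y^α;
  -- equality is coefficientwise (below)
  Poly : Set
  Poly = List (Carrier × Mon m)

  coeff : Poly → Mon m → Carrier
  coeff []             β = 0#
  coeff ((c , α) ∷ f) β with VecP.≡-dec ℕ._≟_ α β
  ... | yes _ = c + coeff f β
  ... | no  _ = coeff f β

  _≐_ : Poly → Poly → Set
  f ≐ g = ∀ β → coeff f β ≈ coeff g β

  0ₚ : Poly
  0ₚ = []

  _+ₚ_ : Poly → Poly → Poly
  _+ₚ_ = _++_

  _*ₚ_ : Poly → Poly → Poly
  f *ₚ g = concatMap (λ { (c , α) → List.map (λ { (d , β) → (c * d , α +ᵐ β) }) g }) f

  var : Fin m → Poly
  var i = (1# , Vec.updateAt (0ᵐ {m}) i (λ _ → 1)) ∷ []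

  powF : Carrier → ℕ → Carrier
  powF x zero    = 1#
  powF x (suc n) = x * powF x n

  evalMon : Vec Carrier m → Mon m → Carrier
  evalMon c α = Vec.foldr _ _*_ 1# (zipWith powF c α)

  eval : Poly → Vec Carrier m → Carrier
  eval f c = foldr (λ { (d , α) acc → d * evalMon c α + acc }) 0# f

  w : Vec Carrier m → ℕ
  w c = count (λ x → ¬? (x ≟ 0#)) c

  InVanishingIdealQ : ℕ → Poly → Set
  InVanishingIdealQ t f = ∀ (c : Vec Carrier m) → w c ℕ.≤ t → eval f c ≈ 0#

  sumₚ : List Poly → Poly
  sumₚ = foldr _+ₚ_ 0ₚ

  _∈⟨_⟩ : Poly → List Poly → Set
  f ∈⟨ S ⟩ = ∃[ h ] (f ≐ sumₚ (List.zipWith _*ₚ_ h S) × length h ≡ length S)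

  squarefreeExps : ℕ → List (Mon m)
  squarefreeExps s =
    List.map (Vec.map boolToℕ)
      (filter (λ b → count (λ x → x Data.Bool.≟ true) b ℕ.≟ s) (allBools m))
    where import Data.Bool

  Mms : ℕ → List Poly
  Mms s = List.map (λ α → (1# , α) ∷ []) (squarefreeExps s)

  σ : ℕ → Poly
  σ s = List.map (λ α → (1# , α)) (squarefreeExps s)

  Eq : List Poly
  Eq = List.map (λ i → (1# , Vec.updateAt (0ᵐ {m}) i (λ _ → q))
                      ∷ (- 1# , Vec.updateAt (0ᵐ {m}) i (λ _ → 1)) ∷ [])
                (List.allFin m)

  vars : List Poly
  vars = List.map var (List.allFin m)

  sigmasFrom : ℕ → List Poly
  sigmasFrom t = List.map (λ k → σ (suc t ℕ.+ k)) (List.upTo (m ℕ.∸ t))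

  Nonzero : Poly → Set
  Nonzero f = ∃[ β ] ¬ (coeff f β ≈ 0#)

  module _ (ord : TermOrder m) where
    open TermOrder ord

    IsLM : Poly → Mon m → Set
    IsLM f α = ¬ (coeff f α ≈ 0#) × (∀ β → ¬ (coeff f β ≈ 0#) → β ≤ α)

    record IsReducedGB (I : Poly → Set) (G : List Poly) : Set where
      field
        G⊆I      : ∀ i → I (List.lookup G i)
        lm       : ∀ i → ∃[ α ] IsLM (List.lookup G i) α
        groebner : ∀ f → I f → Nonzero f →
                   ∃[ i ] ∃[ α ] ∃[ β ] (IsLM (List.lookup G i) α × IsLM f β × α ∣ᵐ β)
        monic    : ∀ i α → IsLM (List.lookup G i) α → coeff (List.lookup G i) α ≈ 1#
        reduced  : ∀ i j → i ≢ j → ∀ α → IsLM (List.lookup G i) α →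
                   ∀ β → ¬ (coeff (List.lookup G j) β ≈ 0#) → ¬ (α ∣ᵐ β)
        distinct : ∀ i j → List.lookup G i ≐ List.lookup G j → i ≡ j

module Submission where

-- After field arithmetic (Fermat: x^q = x) and the calculus of the
-- polynomials of Defs, the KEY LEMMA says that a polynomial
-- whose exponents are all < q and whose monomials each involve at most t
-- variables, and which vanishes on Q_t, is zero (induction on m with the
-- univariate root bound).  Applied to the truncation of f (exponents reduced
-- modulo y^q = y, monomials in more than t variables dropped) it gives:
--   * every f vanishing on F^m lies in ⟨E_q[Y]⟩ (t = m);
--   * the LEADING-MONOMIAL LEMMA: the leading monomial of a nonzero f ∈ I(Q_t)
--     has an exponent ≥ q or involves more than t variables.
-- The ideal equality then follows by interpolating f ∈ I(Q_t) with indicator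
-- polynomials times elementary symmetric polynomials σ_{w(c)} (which do not
-- vanish at c), and the Gröbner basis statement from a general criterion for
-- reduced Gröbner bases whose divisibility condition is the leading-monomial lemma.

open import Defs
open import Level using (0ℓ)
open import Data.Nat as ℕ using (ℕ; zero; suc; z≤n; s≤s; _⊔_; _∸_)
import Data.Nat.Properties as NP
open import Data.Nat.DivMod using (_%_; _/_; m≡m%n+[m/n]*n; m%n<n; m%n≤m; m<n⇒m%n≡m; m≤n⇒[n∸m]%m≡n%m)
open import Data.Bool using (Bool; true; false)
import Data.Bool as B
open import Data.Fin as Fin using (Fin; zero; suc; toℕ)
import Data.Fin.Properties as FinP
import Data.Fin.Permutation as Perm
open import Data.Vec as Vec using (Vec; []; _∷_; lookup; zipWith; count; updateAt)
import Data.Vec.Properties as VecP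
open import Data.List as List using (List; []; _∷_; _++_; concatMap; length; filter)
import Data.List.Properties as LP
open import Data.List.Membership.Propositional using (_∈_)
open import Data.List.Membership.Propositional.Properties
  using (∈-map⁺; ∈-map⁻; ∈-allFin; ∈-++⁺ˡ; ∈-++⁺ʳ; ∈-++⁻; ∈-upTo⁺; ∈-lookup; ∈-filter⁺; ∈-filter⁻; ∈-concatMap⁺)
open import Data.List.Relation.Unary.Any as Any using (here; there)
import Data.List.Relation.Unary.Any.Properties as AnyP
open import Data.List.Relation.Unary.All as All using (All; []; _∷_)
open import Data.List.Relation.Unary.AllPairs using ([]; _∷_)
import Data.List.Relation.Unary.AllPairs as AllPairs
import Data.List.Relation.Unary.AllPairs.Properties as APP
open import Data.List.Relation.Unary.Unique.Propositional using (Unique)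
import Data.List.Relation.Unary.Unique.Propositional.Properties as UP
open import Data.Vec.Relation.Binary.Pointwise.Inductive as Pointwise using (Pointwise; []; _∷_)
open import Data.Product using (Σ; ∃-syntax; _×_; _,_; proj₁; proj₂)
open import Data.Sum using (_⊎_; inj₁; inj₂)
open import Data.Empty using (⊥; ⊥-elim)
open import Data.Maybe using (nothing)
open import Relation.Nullary using (¬_; yes; no; Dec; ¬?)
import Relation.Binary.PropositionalEquality as ≡
open ≡ using (_≡_; _≢_)
open import Relation.Binary.Definitions using (tri<; tri≈; tri>)
open import Relation.Binary.Structures using (IsStrictTotalOrder)
open import Induction.WellFounded using (Acc; acc)
import Algebra.Properties.Ring as RingP
import Algebra.Properties.CommutativeSemigroup as CSemigroupP
import Algebra.Properties.CommutativeMonoid.Sum as CMSum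
open import Tactic.RingSolver using (solve-∀)
open import Tactic.RingSolver.Core.AlmostCommutativeRing using (fromCommutativeRing; AlmostCommutativeRing)
open import Function.Bundles using (_⇔_; mk⇔)

module RingIdentities {q : ℕ} (F : FiniteField q) where
  open FiniteField F using (commRing)

  ACR : AlmostCommutativeRing 0ℓ 0ℓ
  ACR = fromCommutativeRing commRing (λ _ → nothing)

  open AlmostCommutativeRing ACR

  -- the two regroupings in one step of synthetic division by (a - r)
  horner-step₁ : ∀ g a s Q c → g + a * (s * Q + c) ≈ s * (a * Q) + (g + a * c)
  horner-step₁ = solve-∀ ACR

  horner-step₂ : ∀ g a s Q c r → s * (a * Q) + (g + (s + r) * c) ≈ s * (c + a * Q) + (g + r * c)
  horner-step₂ = solve-∀ ACR

  +-regroup₄ : ∀ a b c d → (a + c) + (d + b) ≈ a + ((c + d) + b)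
  +-regroup₄ = solve-∀ ACR

  +-regroup₅ : ∀ a b c d e → a + ((b + c) + (d + e)) ≈ (b + d) + ((a + c) + e)
  +-regroup₅ = solve-∀ ACR


module FieldArithmetic {q : ℕ} (F : FiniteField q) where
  open FiniteField F public hiding (zero)
  open RingIdentities F public using (horner-step₁; horner-step₂; +-regroup₄; +-regroup₅)
  open import Relation.Binary.Reasoning.Setoid setoid public
  open RingP ring public using (-‿distribˡ-*; -‿distribʳ-*; -0#≈0#; -‿+-comm; x≈y⇒x∙y⁻¹≈ε)
  open CSemigroupP *-commutativeSemigroup public
    using () renaming (interchange to *-interchange; x∙yz≈y∙xz to x*[y*z]≈y*[x*z])
  module ∑ = CMSum +-commutativeMonoid
  module ∏ = CMSum *-commutativeMonoid

  *-cancelˡ-≉0 : ∀ {a x y} → ¬ a ≈ 0# → a * x ≈ a * y → x ≈ y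
  *-cancelˡ-≉0 {a} {x} {y} a≉0 ax≈ay with inverse a a≉0
  ... | (a⁻¹ , aa⁻¹≈1) = begin
     x               ≈⟨ sym (*-identityˡ x) ⟩
     1# * x          ≈⟨ *-congʳ (trans (sym aa⁻¹≈1) (*-comm a a⁻¹)) ⟩
     (a⁻¹ * a) * x   ≈⟨ *-assoc a⁻¹ a x ⟩
     a⁻¹ * (a * x)   ≈⟨ *-congˡ ax≈ay ⟩
     a⁻¹ * (a * y)   ≈⟨ sym (*-assoc a⁻¹ a y) ⟩
     (a⁻¹ * a) * y   ≈⟨ *-congʳ (trans (*-comm a⁻¹ a) aa⁻¹≈1) ⟩
     1# * y          ≈⟨ *-identityˡ y ⟩
     y ∎

  ≉0*x≈0⇒x≈0 : ∀ {a x} → ¬ a ≈ 0# → a * x ≈ 0# → x ≈ 0#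
  ≉0*x≈0⇒x≈0 {a} a≉0 ax≈0 = *-cancelˡ-≉0 a≉0 (trans ax≈0 (sym (zeroʳ a)))

  *-preserves-≉0 : ∀ {x y} → ¬ x ≈ 0# → ¬ y ≈ 0# → ¬ (x * y) ≈ 0#
  *-preserves-≉0 x≉0 y≉0 xy≈0 = y≉0 (≉0*x≈0⇒x≈0 x≉0 xy≈0)

  ≉⇒difference≉0 : ∀ {a r} → ¬ a ≈ r → ¬ (a - r) ≈ 0#
  ≉⇒difference≉0 {a} {r} a≉r a-r≈0 = a≉r (begin
    a             ≈⟨ sym (+-identityʳ a) ⟩
    a + 0#        ≈⟨ +-congˡ (sym (-‿inverseˡ r)) ⟩
    a + (- r + r) ≈⟨ sym (+-assoc a (- r) r) ⟩
    (a - r) + r   ≈⟨ +-congʳ a-r≈0 ⟩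
    0# + r        ≈⟨ +-identityˡ r ⟩
    r ∎)

  pow : Carrier → ℕ → Carrier
  pow x zero = 1#
  pow x (suc n) = x * pow x n

  pow-cong : ∀ {x y} n → x ≈ y → pow x n ≈ pow y n
  pow-cong zero e = refl
  pow-cong (suc n) e = *-cong e (pow-cong n e)

  pow-+ : ∀ x m n → pow x (m ℕ.+ n) ≈ pow x m * pow x n
  pow-+ x zero n = sym (*-identityˡ _)
  pow-+ x (suc m) n = trans (*-congˡ (pow-+ x m n)) (sym (*-assoc _ _ _))

  pow-0# : ∀ n → pow 0# (suc n) ≈ 0#
  pow-0# n = zeroˡ _

  ΣFin : ∀ n → (Fin n → Carrier) → Carrier
  ΣFin n g = ∑.sum g

  ΣFin-cong : ∀ n {g h : Fin n → Carrier} → (∀ i → g i ≈ h i) → ΣFin n g ≈ ΣFin n h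
  ΣFin-cong n e = ∑.sum-cong-≋ e

  ΣFin-≈0 : ∀ n {g : Fin n → Carrier} → (∀ i → g i ≈ 0#) → ΣFin n g ≈ 0#
  ΣFin-≈0 n e = trans (ΣFin-cong n e) (∑.sum-replicate-zero n)

  ΣFin-+ : ∀ n (g h : Fin n → Carrier) → ΣFin n (λ i → g i + h i) ≈ ΣFin n g + ΣFin n h
  ΣFin-+ n g h = ∑.∑-distrib-+ g h

  ΣFin-*ˡ : ∀ n a (g : Fin n → Carrier) → ΣFin n (λ i → a * g i) ≈ a * ΣFin n g
  ΣFin-*ˡ zero a g = sym (zeroʳ a)
  ΣFin-*ˡ (suc n) a g = trans (+-congˡ (ΣFin-*ˡ n a _)) (sym (distribˡ a _ _))

  ΣFin-single : ∀ n (i₀ : Fin n) (g : Fin n → Carrier) → (∀ i → i ≢ i₀ → g i ≈ 0#) → ΣFin n g ≈ g i₀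
  ΣFin-single (suc n) zero g e =
    trans (+-congˡ (ΣFin-≈0 n (λ i → e (suc i) (λ ())))) (+-identityʳ _)
  ΣFin-single (suc n) (suc i₀) g e =
    trans (+-congʳ (e zero (λ ()))) (trans (+-identityˡ _)
      (ΣFin-single n i₀ (λ i → g (suc i)) (λ i ne → e (suc i) (λ p → ne (FinP.suc-injective p)))))

  q≥2 : ∃[ q' ] (q ≡ suc (suc q'))
  q≥2 = size≥2 (proj₁ (enum-surj 0#)) (proj₁ (enum-surj 1#)) index0≢index1
    where
    size≥2 : ∀ {n} (i j : Fin n) → i ≢ j → ∃[ n' ] (n ≡ suc (suc n'))
    size≥2 {suc zero} zero zero i≢j = ⊥-elim (i≢j ≡.refl)
    size≥2 {suc (suc n)} i j _ = n , ≡.refl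
    index0≢index1 : proj₁ (enum-surj 0#) ≢ proj₁ (enum-surj 1#)
    index0≢index1 e = 0≉1 (trans (sym (proj₂ (enum-surj 0#)))
                        (trans (reflexive (≡.cong enum e)) (proj₂ (enum-surj 1#))))

  -- For
  -- x ≉ 0, multiplication by x permutes the elements; comparing the products of
  -- all elements (with 0 replaced by 1) before and after this permutation gives
  -- x ^ n · P = P with P ≉ 0, hence x ^ n = 1.
  module Fermat {n : ℕ} (e : Fin (suc n) → Carrier)
                (e-inj : ∀ i j → e i ≈ e j → i ≡ j) (e-surj : ∀ y → ∃[ i ] (e i ≈ y))
                {x : Carrier} (x≉0 : ¬ x ≈ 0#) where
    Π : ∀ {k} → (Fin k → Carrier) → Carrier
    Π = ∏.sum

    x⁻¹ : Carrier
    x⁻¹ = proj₁ (inverse x x≉0)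

    cancel : ∀ {a b} y → a * b ≈ 1# → a * (b * y) ≈ y
    cancel {a} {b} y ab≈1 = trans (sym (*-assoc a b y)) (trans (*-congʳ ab≈1) (*-identityˡ y))

    index : Carrier → Fin (suc n)
    index y = proj₁ (e-surj y)

    scaling : Perm.Permutation (suc n) (suc n)
    scaling = Perm.permutation (λ i → index (x * e i)) (λ j → index (x⁻¹ * e j)) inv₁ inv₂
      where
      xx⁻¹≈1 : x * x⁻¹ ≈ 1#
      xx⁻¹≈1 = proj₂ (inverse x x≉0)
      inv₁ : ∀ j → index (x * e (index (x⁻¹ * e j))) ≡ j
      inv₁ j = e-inj _ _ (trans (proj₂ (e-surj _))
                 (trans (*-congˡ (proj₂ (e-surj _))) (cancel (e j) xx⁻¹≈1)))
      inv₂ : ∀ j → index (x⁻¹ * e (index (x * e j))) ≡ j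
      inv₂ j = e-inj _ _ (trans (proj₂ (e-surj _))
                 (trans (*-congˡ (proj₂ (e-surj _))) (cancel (e j) (trans (*-comm x⁻¹ x) xx⁻¹≈1))))

    nonzeroOrOne : Carrier → Carrier
    nonzeroOrOne y with y ≟ 0#
    ... | yes _ = 1#
    ... | no _ = y

    nonzeroOrOne-≉0 : ∀ y → ¬ nonzeroOrOne y ≈ 0#
    nonzeroOrOne-≉0 y with y ≟ 0#
    ... | yes _ = λ 1≈0 → 0≉1 (sym 1≈0)
    ... | no y≉0 = y≉0

    nonzeroOrOne-cong : ∀ {y z} → y ≈ z → nonzeroOrOne y ≈ nonzeroOrOne z
    nonzeroOrOne-cong {y} {z} y≈z with y ≟ 0# | z ≟ 0#
    ... | yes _   | yes _   = refl
    ... | yes y≈0 | no z≉0  = ⊥-elim (z≉0 (trans (sym y≈z) y≈0))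
    ... | no y≉0  | yes z≈0 = ⊥-elim (y≉0 (trans y≈z z≈0))
    ... | no _    | no _    = y≈z

    nonzeroOrOne-zero : ∀ {y} → y ≈ 0# → nonzeroOrOne y ≈ 1#
    nonzeroOrOne-zero {y} y≈0 with y ≟ 0#
    ... | yes _ = refl
    ... | no y≉0 = ⊥-elim (y≉0 y≈0)

    nonzeroOrOne-nonzero : ∀ {y} → ¬ y ≈ 0# → nonzeroOrOne y ≈ y
    nonzeroOrOne-nonzero {y} y≉0 with y ≟ 0#
    ... | yes y≈0 = ⊥-elim (y≉0 y≈0)
    ... | no _ = refl

    factor : Fin (suc n) → Carrier
    factor i with e i ≟ 0#
    ... | yes _ = 1#
    ... | no _ = x

    scaled-term : ∀ i → nonzeroOrOne (e (index (x * e i))) ≈ factor i * nonzeroOrOne (e i)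
    scaled-term i with e i ≟ 0#
    ... | yes ei≈0 = trans (nonzeroOrOne-cong (proj₂ (e-surj _)))
                       (trans (nonzeroOrOne-zero (trans (*-congˡ ei≈0) (zeroʳ x))) (sym (*-identityˡ 1#)))
    ... | no ei≉0 = trans (nonzeroOrOne-cong (proj₂ (e-surj _)))
                      (nonzeroOrOne-nonzero (*-preserves-≉0 x≉0 ei≉0))

    -- exactly one factor (at the index of 0) is 1, the other n are x
    Π-factor : Π factor ≈ pow x n
    Π-factor = trans (∏.sum-remove {i = i₀} factor)
                 (trans (*-cong factor-i₀ (Π-const n _ factor-rest)) (*-identityˡ _))
      where
      i₀ : Fin (suc n)
      i₀ = index 0#
      factor-i₀ : factor i₀ ≈ 1#
      factor-i₀ with e i₀ ≟ 0#
      ... | yes _ = refl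
      ... | no e-i₀≉0 = ⊥-elim (e-i₀≉0 (proj₂ (e-surj 0#)))
      factor-rest : ∀ j → factor (Fin.punchIn i₀ j) ≈ x
      factor-rest j with e (Fin.punchIn i₀ j) ≟ 0#
      ... | yes p = ⊥-elim (FinP.punchInᵢ≢i i₀ j (e-inj _ _ (trans p (sym (proj₂ (e-surj 0#))))))
      ... | no _ = refl
      Π-const : ∀ k (g : Fin k → Carrier) → (∀ i → g i ≈ x) → Π g ≈ pow x k
      Π-const zero g _ = refl
      Π-const (suc k) g g≈x = *-cong (g≈x zero) (Π-const k (λ i → g (suc i)) (λ i → g≈x (suc i)))

    Π-≉0 : ∀ k (g : Fin k → Carrier) → (∀ i → ¬ g i ≈ 0#) → ¬ Π g ≈ 0#
    Π-≉0 zero g _ 1≈0 = 0≉1 (sym 1≈0)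
    Π-≉0 (suc k) g g≉0 = *-preserves-≉0 (g≉0 zero) (Π-≉0 k (λ i → g (suc i)) (λ i → g≉0 (suc i)))

    pow-n≈1 : pow x n ≈ 1#
    pow-n≈1 = *-cancelˡ-≉0 P≉0 (begin
      P * pow x n               ≈⟨ *-comm P _ ⟩
      pow x n * P               ≈⟨ *-congʳ (sym Π-factor) ⟩
      Π factor * P              ≈⟨ sym (∏.∑-distrib-+ factor terms) ⟩
      Π (λ i → factor i * terms i) ≈⟨ sym (∏.sum-cong-≋ scaled-term) ⟩
      Π (λ i → terms (Perm._⟨$⟩ʳ_ scaling i)) ≈⟨ sym (∏.sum-permute terms scaling) ⟩
      P                         ≈⟨ sym (*-identityʳ P) ⟩
      P * 1# ∎)
      where
      terms : Fin (suc n) → Carrier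
      terms i = nonzeroOrOne (e i)
      P : Carrier
      P = Π terms
      P≉0 : ¬ P ≈ 0#
      P≉0 = Π-≉0 (suc n) terms (λ i → nonzeroOrOne-≉0 (e i))

  fermat-general : ∀ n (e : Fin n → Carrier) → (∀ i j → e i ≈ e j → i ≡ j) →
                   (∀ y → ∃[ i ] (e i ≈ y)) → ∀ x → pow x n ≈ x
  fermat-general zero e _ e-surj x with proj₁ (e-surj x)
  ... | ()
  fermat-general (suc n) e e-inj e-surj x with x ≟ 0#
  ... | yes x≈0 = trans (*-congʳ x≈0) (trans (zeroˡ _) (sym x≈0))
  ... | no x≉0 = trans (*-congˡ (Fermat.pow-n≈1 e e-inj e-surj x≉0)) (*-identityʳ x)

  fermat : ∀ x → pow x q ≈ x
  fermat = fermat-general q enum enum-inj enum-surj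


module Monomials {q : ℕ} (F : FiniteField q) where
  open import Data.Nat using (_≤_; _<_)
  open FieldArithmetic F public

  monValue : ∀ {m} → Vec Carrier m → Mon m → Carrier
  monValue [] [] = 1#
  monValue (a ∷ c) (b ∷ β) = pow a b * monValue c β

  monValue-+ᵐ : ∀ {m} (c : Vec Carrier m) α β → monValue c (α +ᵐ β) ≈ monValue c α * monValue c β
  monValue-+ᵐ [] [] [] = sym (*-identityˡ 1#)
  monValue-+ᵐ (a ∷ c) (x ∷ α) (y ∷ β) = begin
    pow a (x ℕ.+ y) * monValue c (α +ᵐ β)               ≈⟨ *-cong (pow-+ a x y) (monValue-+ᵐ c α β) ⟩
    (pow a x * pow a y) * (monValue c α * monValue c β) ≈⟨ *-interchange _ _ _ _ ⟩
    (pow a x * monValue c α) * (pow a y * monValue c β) ∎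

  _≈v_ : ∀ {m} → Vec Carrier m → Vec Carrier m → Set
  _≈v_ = Pointwise _≈_

  monValue-cong : ∀ {m} {c d : Vec Carrier m} α → c ≈v d → monValue c α ≈ monValue d α
  monValue-cong [] [] = refl
  monValue-cong (x ∷ α) (a≈b ∷ c≈d) = *-cong (pow-cong x a≈b) (monValue-cong α c≈d)

  wt : ∀ {m} → Vec Carrier m → ℕ
  wt c = count (λ x → ¬? (x ≟ 0#)) c

  wt-∷-zero : ∀ {m} {a} (c : Vec Carrier m) → a ≈ 0# → wt (a ∷ c) ≡ wt c
  wt-∷-zero {a = a} c a≈0 with a ≟ 0#
  ... | yes _ = ≡.refl
  ... | no a≉0 = ⊥-elim (a≉0 a≈0)

  wt-∷-nonzero : ∀ {m} {a} (c : Vec Carrier m) → ¬ a ≈ 0# → wt (a ∷ c) ≡ suc (wt c)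
  wt-∷-nonzero {a = a} c a≉0 with a ≟ 0#
  ... | yes a≈0 = ⊥-elim (a≉0 a≈0)
  ... | no _ = ≡.refl

  wt-≤ : ∀ {m} (c : Vec Carrier m) → wt c ≤ m
  wt-≤ [] = z≤n
  wt-≤ (a ∷ c) with a ≟ 0#
  ... | yes _ = NP.m≤n⇒m≤1+n (wt-≤ c)
  ... | no _ = s≤s (wt-≤ c)

  wt-cong : ∀ {m} {c d : Vec Carrier m} → c ≈v d → wt c ≡ wt d
  wt-cong [] = ≡.refl
  wt-cong {c = a ∷ c} {b ∷ d} (a≈b ∷ c≈d) = by-cases (a ≟ 0#)
    where
    by-cases : Dec (a ≈ 0#) → wt (a ∷ c) ≡ wt (b ∷ d)
    by-cases (yes a≈0) = ≡.trans (wt-∷-zero c a≈0)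
      (≡.trans (wt-cong c≈d) (≡.sym (wt-∷-zero d (trans (sym a≈b) a≈0))))
    by-cases (no a≉0) = ≡.trans (wt-∷-nonzero c a≉0)
      (≡.trans (≡.cong suc (wt-cong c≈d)) (≡.sym (wt-∷-nonzero d (λ b≈0 → a≉0 (trans a≈b b≈0)))))

  supp : ∀ {m} → Mon m → ℕ
  supp α = count (λ n → ¬? (n ℕ.≟ 0)) α

  supp-≤ : ∀ {m} (α : Mon m) → supp α ≤ m
  supp-≤ [] = z≤n
  supp-≤ (zero ∷ α) = NP.m≤n⇒m≤1+n (supp-≤ α)
  supp-≤ (suc n ∷ α) = s≤s (supp-≤ α)

  -- pigeonhole: a monomial in more variables than w(c) vanishes at c
  monValue≈0-if-wt<supp : ∀ {m} (c : Vec Carrier m) (β : Mon m) → wt c < supp β → monValue c β ≈ 0#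
  monValue≈0-if-wt<supp [] [] ()
  monValue≈0-if-wt<supp (a ∷ c) (b ∷ β) lt with a ≟ 0# | b
  ... | yes a≈0 | zero   = trans (*-identityˡ _) (monValue≈0-if-wt<supp c β lt)
  ... | yes a≈0 | suc b' = trans (*-congʳ (trans (pow-cong (suc b') a≈0) (pow-0# b'))) (zeroˡ _)
  ... | no _    | zero   = trans (*-identityˡ _) (monValue≈0-if-wt<supp c β (NP.<-trans (NP.n<1+n _) lt))
  ... | no _    | suc b' = trans (*-congˡ (monValue≈0-if-wt<supp c β (NP.≤-pred lt))) (zeroʳ _)

  ΣBox : ∀ n m → (Vec (Fin n) m → Carrier) → Carrier
  ΣBox n zero G = G []
  ΣBox n (suc m) G = ΣFin n (λ k → ΣBox n m (λ α → G (k ∷ α)))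

  ΣBox-cong : ∀ n m {G H : Vec (Fin n) m → Carrier} → (∀ α → G α ≈ H α) → ΣBox n m G ≈ ΣBox n m H
  ΣBox-cong n zero e = e []
  ΣBox-cong n (suc m) e = ΣFin-cong n (λ k → ΣBox-cong n m (λ α → e (k ∷ α)))

  ΣBox-≈0 : ∀ n m {G : Vec (Fin n) m → Carrier} → (∀ α → G α ≈ 0#) → ΣBox n m G ≈ 0#
  ΣBox-≈0 n zero e = e []
  ΣBox-≈0 n (suc m) e = ΣFin-≈0 n (λ k → ΣBox-≈0 n m (λ α → e (k ∷ α)))

  ΣBox-+ : ∀ n m (G H : Vec (Fin n) m → Carrier) → ΣBox n m (λ α → G α + H α) ≈ ΣBox n m G + ΣBox n m H
  ΣBox-+ n zero G H = refl
  ΣBox-+ n (suc m) G H = trans (ΣFin-cong n (λ k → ΣBox-+ n m _ _)) (ΣFin-+ n _ _)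

  ΣBox-*ˡ : ∀ n m a (G : Vec (Fin n) m → Carrier) → ΣBox n m (λ α → a * G α) ≈ a * ΣBox n m G
  ΣBox-*ˡ n zero a G = refl
  ΣBox-*ˡ n (suc m) a G = trans (ΣFin-cong n (λ k → ΣBox-*ˡ n m a _)) (ΣFin-*ˡ n a _)

  ΣBox-single : ∀ n m (α₀ : Vec (Fin n) m) (G : Vec (Fin n) m → Carrier) →
                (∀ α → α ≢ α₀ → G α ≈ 0#) → ΣBox n m G ≈ G α₀
  ΣBox-single n zero [] G e = refl
  ΣBox-single n (suc m) (k₀ ∷ α₀) G e =
    trans (ΣFin-single n k₀ _ (λ k k≢k₀ → ΣBox-≈0 n m (λ α → e (k ∷ α) (λ p → k≢k₀ (VecP.∷-injectiveˡ p)))))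
          (ΣBox-single n m α₀ (λ α → G (k₀ ∷ α)) (λ α α≢α₀ → e (k₀ ∷ α) (λ p → α≢α₀ (VecP.∷-injectiveʳ p))))

  toExp : ∀ {n m} → Vec (Fin n) m → Mon m
  toExp = Vec.map toℕ

  toExp-injective : ∀ {n m} (α β : Vec (Fin n) m) → toExp α ≡ toExp β → α ≡ β
  toExp-injective [] [] e = ≡.refl
  toExp-injective (a ∷ α) (b ∷ β) e =
    ≡.cong₂ _∷_ (FinP.toℕ-injective (VecP.∷-injectiveˡ e)) (toExp-injective α β (VecP.∷-injectiveʳ e))


-- The univariate root bound in the form needed here: a polynomial
-- ∑_{k<n} g k · a^k that vanishes at n distinct points has all coefficients 0.
-- Proof by synthetic division by (a - r) for a root r.
module UnivariateRoots {q : ℕ} (F : FiniteField q) where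
  open Monomials F public

  uniPoly : ∀ n → (Fin n → Carrier) → Carrier → Carrier
  uniPoly n g a = ΣFin n (λ k → pow a (toℕ k) * g k)

  uniPoly-cong : ∀ n g {a b} → a ≈ b → uniPoly n g a ≈ uniPoly n g b
  uniPoly-cong n g a≈b = ΣFin-cong n (λ k → *-congʳ (pow-cong (toℕ k) a≈b))

  uniPoly-suc : ∀ n g a → uniPoly (suc n) g a ≈ g zero + a * uniPoly n (λ k → g (suc k)) a
  uniPoly-suc n g a = +-cong (*-identityˡ _)
    (trans (ΣFin-cong n (λ k → *-assoc a _ _)) (ΣFin-*ˡ n a _))

  quotientByRoot : ∀ n → Carrier → (Fin (suc n) → Carrier) → Fin n → Carrier
  quotientByRoot zero r g ()
  quotientByRoot (suc n) r g zero = uniPoly (suc n) (λ k → g (suc k)) r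
  quotientByRoot (suc n) r g (suc k) = quotientByRoot n r (λ k → g (suc k)) k

  uniPoly-division : ∀ n r g a →
    uniPoly (suc n) g a ≈ (a - r) * uniPoly n (quotientByRoot n r g) a + uniPoly (suc n) g r
  uniPoly-division zero r g a = begin
    uniPoly 1 g a                ≈⟨ uniPoly-suc 0 g a ⟩
    g zero + a * 0#              ≈⟨ +-congˡ (trans (zeroʳ a) (sym (zeroʳ r))) ⟩
    g zero + r * 0#              ≈⟨ sym (uniPoly-suc 0 g r) ⟩
    uniPoly 1 g r                ≈⟨ sym (+-identityˡ _) ⟩
    0# + uniPoly 1 g r           ≈⟨ +-congʳ (sym (zeroʳ _)) ⟩
    (a - r) * 0# + uniPoly 1 g r ∎
  uniPoly-division (suc n) r g a = begin
    uniPoly (suc (suc n)) g a                        ≈⟨ uniPoly-suc (suc n) g a ⟩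
    g zero + a * uniPoly (suc n) g' a                ≈⟨ +-congˡ (*-congˡ (uniPoly-division n r g' a)) ⟩
    g zero + a * ((a - r) * Q + c)                   ≈⟨ horner-step₁ _ _ _ _ _ ⟩
    (a - r) * (a * Q) + (g zero + a * c)             ≈⟨ +-congˡ (+-congˡ (*-congʳ (sym a-r+r≈a))) ⟩
    (a - r) * (a * Q) + (g zero + ((a - r) + r) * c) ≈⟨ horner-step₂ _ _ _ _ _ _ ⟩
    (a - r) * (c + a * Q) + (g zero + r * c)
      ≈⟨ +-cong (*-congˡ (sym (uniPoly-suc n (quotientByRoot (suc n) r g) a))) (sym (uniPoly-suc (suc n) g r)) ⟩
    (a - r) * uniPoly (suc n) (quotientByRoot (suc n) r g) a + uniPoly (suc (suc n)) g r ∎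
    where
    g' = λ k → g (suc k)
    Q = uniPoly n (quotientByRoot n r g') a
    c = uniPoly (suc n) g' r
    a-r+r≈a : (a - r) + r ≈ a
    a-r+r≈a = trans (+-assoc a (- r) r) (trans (+-congˡ (-‿inverseˡ r)) (+-identityʳ a))

  quotient≈0⇒coeffs≈0 : ∀ n r g → (∀ k → quotientByRoot n r g k ≈ 0#) →
                        uniPoly (suc n) g r ≈ 0# → ∀ k → g k ≈ 0#
  quotient≈0⇒coeffs≈0 zero r g _ p[r]≈0 zero =
    trans (sym (trans (uniPoly-suc 0 g r) (trans (+-congˡ (zeroʳ r)) (+-identityʳ _)))) p[r]≈0
  quotient≈0⇒coeffs≈0 (suc n) r g quot≈0 p[r]≈0 zero = begin
    g zero                            ≈⟨ sym (+-identityʳ _) ⟩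
    g zero + 0#                       ≈⟨ +-congˡ (sym (zeroʳ r)) ⟩
    g zero + r * 0#                   ≈⟨ +-congˡ (*-congˡ (sym (quot≈0 zero))) ⟩
    g zero + r * uniPoly (suc n) (λ k → g (suc k)) r ≈⟨ sym (uniPoly-suc (suc n) g r) ⟩
    uniPoly (suc (suc n)) g r         ≈⟨ p[r]≈0 ⟩
    0# ∎
  quotient≈0⇒coeffs≈0 (suc n) r g quot≈0 p[r]≈0 (suc k) =
    quotient≈0⇒coeffs≈0 n r (λ k → g (suc k)) (λ k → quot≈0 (suc k)) (quot≈0 zero) k

  vanishing-uniPoly⇒coeffs≈0 : ∀ n (z : Fin n → Carrier) → (∀ i j → z i ≈ z j → i ≡ j) →
    (g : Fin n → Carrier) → (∀ j → uniPoly n g (z j) ≈ 0#) → ∀ k → g k ≈ 0#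
  vanishing-uniPoly⇒coeffs≈0 zero z z-inj g vanish ()
  vanishing-uniPoly⇒coeffs≈0 (suc n) z z-inj g vanish = quotient≈0⇒coeffs≈0 n r g quot≈0 (vanish zero)
    where
    r = z zero
    -- the quotient vanishes at the remaining n points z (suc j), since z (suc j) - r ≉ 0
    quot-vanishes : ∀ j → uniPoly n (quotientByRoot n r g) (z (suc j)) ≈ 0#
    quot-vanishes j = ≉0*x≈0⇒x≈0 (≉⇒difference≉0 (λ e → FinP.0≢1+n (≡.sym (z-inj (suc j) zero e))))
      (trans (sym (+-identityʳ _)) (trans (+-congˡ (sym (vanish zero)))
        (trans (sym (uniPoly-division n r g (z (suc j)))) (vanish (suc j)))))
    quot≈0 : ∀ k → quotientByRoot n r g k ≈ 0#
    quot≈0 = vanishing-uniPoly⇒coeffs≈0 n (λ j → z (suc j)) (λ i j e → FinP.suc-injective (z-inj _ _ e))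
               (quotientByRoot n r g) quot-vanishes


-- A polynomial all of whose exponents are < q is
-- described by its coefficients C : Vec (Fin q) m → F.  If every monomial of C
-- involves at most t variables and C vanishes on Q_t = {c | w(c) ≤ t}, then
-- C = 0.  Induction on m: write C = ∑_k y₁^k · C_k(y₂,…,yₘ).  Points with
-- c₁ = 0 show C₀ vanishes on Q_t (so C₀ = 0); then for fixed (c₂,…,cₘ) of weight
-- ≤ t-1 the univariate polynomial in c₁ vanishes on all of F, so every C_k
-- vanishes on Q_{t-1}, and its monomials (with y₁ removed) involve ≤ t-1 variables.
module LowSupportPolynomials {q : ℕ} (F : FiniteField q) where
  open import Data.Nat using (_≤_; _<_)
  open UnivariateRoots F public

  boxPoly : ∀ m → (Vec (Fin q) m → Carrier) → Vec Carrier m → Carrier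
  boxPoly m C x = ΣBox q m (λ α → C α * monValue x (toExp α))

  boxPoly-suc : ∀ m (C : Vec (Fin q) (suc m) → Carrier) a x →
                boxPoly (suc m) C (a ∷ x) ≈ uniPoly q (λ k → boxPoly m (λ α → C (k ∷ α)) x) a
  boxPoly-suc m C a x =
    ΣFin-cong q (λ k → trans (ΣBox-cong q m (λ α → x*[y*z]≈y*[x*z] _ _ _)) (ΣBox-*ˡ q m _ _))

  fin0 : Fin q
  fin0 = Fin.fromℕ< {0} {q} (≡.subst (0 <_) (≡.sym (proj₂ q≥2)) (s≤s z≤n))

  toℕ-fin0 : toℕ fin0 ≡ 0
  toℕ-fin0 = FinP.toℕ-fromℕ< _

  uniPoly-at-0# : ∀ g → uniPoly q g 0# ≈ g fin0
  uniPoly-at-0# g = trans (ΣFin-single q fin0 _ higher-terms≈0)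
                      (trans (*-congʳ (≡.subst (λ n → pow 0# n ≈ 1#) (≡.sym toℕ-fin0) refl)) (*-identityˡ _))
    where
    higher-terms≈0 : ∀ k → k ≢ fin0 → pow 0# (toℕ k) * g k ≈ 0#
    higher-terms≈0 k k≢0 with toℕ k in eq
    ... | zero = ⊥-elim (k≢0 (FinP.toℕ-injective (≡.trans eq (≡.sym toℕ-fin0))))
    ... | suc n = trans (*-congʳ (pow-0# n)) (zeroˡ _)

  LowSupportVanishing : ∀ m → ℕ → (Vec (Fin q) m → Carrier) → Set
  LowSupportVanishing m t C = (∀ α → t < supp (toExp α) → C α ≈ 0#)
                            × (∀ x → wt x ≤ t → boxPoly m C x ≈ 0#)

  -- the slice C₀ = C (0 ∷ _) inherits the hypotheses (evaluate at points 0 ∷ x)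
  slice0-lowSupportVanishing : ∀ m t (C : Vec (Fin q) (suc m) → Carrier) →
    LowSupportVanishing (suc m) t C → LowSupportVanishing m t (λ α → C (fin0 ∷ α))
  slice0-lowSupportVanishing m t C (high≈0 , vanish) = high≈0′ , vanish′
    where
    high≈0′ : ∀ α → t < supp (toExp α) → C (fin0 ∷ α) ≈ 0#
    high≈0′ α lt = high≈0 (fin0 ∷ α) (≡.subst (λ n → t < supp (n ∷ toExp α)) (≡.sym toℕ-fin0) lt)
    vanish′ : ∀ x → wt x ≤ t → boxPoly m (λ α → C (fin0 ∷ α)) x ≈ 0#
    vanish′ x wt≤t = trans (sym (uniPoly-at-0# (λ j → boxPoly m (λ α → C (j ∷ α)) x)))
                       (trans (sym (boxPoly-suc m C 0# x))
                         (vanish (0# ∷ x) (≡.subst (_≤ t) (≡.sym (wt-∷-zero x refl)) wt≤t)))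

  slice-lowSupportVanishing : ∀ m t (C : Vec (Fin q) (suc m) → Carrier) →
    LowSupportVanishing (suc m) (suc t) C → (∀ α → C (fin0 ∷ α) ≈ 0#) →
    ∀ j → toℕ j ≢ 0 → LowSupportVanishing m t (λ α → C (j ∷ α))
  slice-lowSupportVanishing m t C (high≈0 , vanish) C₀≈0 j j≢0 = high≈0′ , vanish′
    where
    high≈0′ : ∀ α → t < supp (toExp α) → C (j ∷ α) ≈ 0#
    high≈0′ α lt = high≈0 (j ∷ α) (head-counts (toℕ j) j≢0)
      where
      head-counts : ∀ n → n ≢ 0 → suc t < supp (n ∷ toExp α)
      head-counts zero n≢0 = ⊥-elim (n≢0 ≡.refl)
      head-counts (suc n) _ = s≤s lt
    -- for fixed x, the univariate polynomial a ↦ boxPoly (a ∷ x) vanishes on all of F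
    vanish′ : ∀ x → wt x ≤ t → boxPoly m (λ α → C (j ∷ α)) x ≈ 0#
    vanish′ x wt≤t = vanishing-uniPoly⇒coeffs≈0 q enum enum-inj slices vanish-at j
      where
      slices : Fin q → Carrier
      slices k = boxPoly m (λ α → C (k ∷ α)) x
      vanish-at : ∀ i → uniPoly q slices (enum i) ≈ 0#
      vanish-at i with enum i ≟ 0#
      ... | yes a≈0 = trans (uniPoly-cong q slices a≈0) (trans (uniPoly-at-0# slices)
                        (ΣBox-≈0 q m (λ α → trans (*-congʳ (C₀≈0 α)) (zeroˡ _))))
      ... | no a≉0 = trans (sym (boxPoly-suc m C (enum i) x))
                       (vanish (enum i ∷ x) (≡.subst (_≤ suc t) (≡.sym (wt-∷-nonzero x a≉0)) (s≤s wt≤t)))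

  lowSupportVanishing⇒coeffs≈0 : ∀ m t (C : Vec (Fin q) m → Carrier) →
                                 LowSupportVanishing m t C → ∀ α → C α ≈ 0#
  lowSupportVanishing⇒coeffs≈0 zero t C (_ , vanish) [] = trans (sym (*-identityʳ _)) (vanish [] z≤n)
  lowSupportVanishing⇒coeffs≈0 (suc m) t C hyp (k ∷ α) with toℕ k ℕ.≟ 0
  ... | yes k≡0 = ≡.subst (λ j → C (j ∷ α) ≈ 0#) (≡.sym (FinP.toℕ-injective (≡.trans k≡0 (≡.sym toℕ-fin0))))
                    (lowSupportVanishing⇒coeffs≈0 m t _ (slice0-lowSupportVanishing m t C hyp) α)
  lowSupportVanishing⇒coeffs≈0 (suc m) zero C (high≈0 , _) (k ∷ α) | no k≢0 =
    high≈0 (k ∷ α) (positive-head (toℕ k) k≢0)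
    where
    positive-head : ∀ n → n ≢ 0 → 0 < supp (n ∷ toExp α)
    positive-head zero n≢0 = ⊥-elim (n≢0 ≡.refl)
    positive-head (suc n) _ = s≤s z≤n
  lowSupportVanishing⇒coeffs≈0 (suc m) (suc t) C hyp (k ∷ α) | no k≢0 =
    lowSupportVanishing⇒coeffs≈0 m t _
      (slice-lowSupportVanishing m t C hyp
        (lowSupportVanishing⇒coeffs≈0 m (suc t) _ (slice0-lowSupportVanishing m (suc t) C hyp)) k k≢0) α


-- The latter goes
-- through a normal form: every polynomial has its exponents in some box
-- Vec (Fin n) m, and then eval f x = ∑_{β in the box} coeff f β · x^β.
module PolynomialCalculus {q : ℕ} (F : FiniteField q) (m : ℕ) where
  open import Data.Nat using (_≤_; _<_)
  open LowSupportPolynomials F public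
  open Polynomials F m public

  powF≈pow : ∀ x n → powF x n ≈ pow x n
  powF≈pow x zero = refl
  powF≈pow x (suc n) = *-congˡ (powF≈pow x n)

  evalMon≈monValue : ∀ {k} (c : Vec Carrier k) (α : Mon k) →
    Vec.foldr _ _*_ 1# (zipWith powF c α) ≈ monValue c α
  evalMon≈monValue [] [] = refl
  evalMon≈monValue (a ∷ c) (b ∷ α) = *-cong (powF≈pow a b) (evalMon≈monValue c α)

  coeffTerm : Carrier → Mon m → Mon m → Carrier
  coeffTerm d α β = coeff ((d , α) ∷ []) β

  coeff-cons : ∀ d α f β → coeff ((d , α) ∷ f) β ≈ coeffTerm d α β + coeff f β
  coeff-cons d α f β with VecP.≡-dec ℕ._≟_ α β
  ... | yes _ = +-congʳ (sym (+-identityʳ d))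
  ... | no _ = sym (+-identityˡ _)

  coeffTerm-same : ∀ d α → coeffTerm d α α ≈ d
  coeffTerm-same d α with VecP.≡-dec ℕ._≟_ α α
  ... | yes _ = +-identityʳ d
  ... | no α≢α = ⊥-elim (α≢α ≡.refl)

  coeffTerm-other : ∀ d α β → α ≢ β → coeffTerm d α β ≈ 0#
  coeffTerm-other d α β α≢β with VecP.≡-dec ℕ._≟_ α β
  ... | yes α≡β = ⊥-elim (α≢β α≡β)
  ... | no _ = refl

  coeffTerm-0# : ∀ α β → coeffTerm 0# α β ≈ 0#
  coeffTerm-0# α β with VecP.≡-dec ℕ._≟_ α β
  ... | yes _ = +-identityʳ 0#
  ... | no _ = refl

  coeffTerm-cong : ∀ {a b} α β → a ≈ b → coeffTerm a α β ≈ coeffTerm b α β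
  coeffTerm-cong α β a≈b with VecP.≡-dec ℕ._≟_ α β
  ... | yes _ = +-congʳ a≈b
  ... | no _ = refl

  coeffTerm-cancel : ∀ d γ β → coeffTerm (- d) γ β + coeffTerm d γ β ≈ 0#
  coeffTerm-cancel d γ β with VecP.≡-dec ℕ._≟_ γ β
  ... | yes _ = trans (+-cong (+-identityʳ _) (+-identityʳ _)) (-‿inverseˡ d)
  ... | no _ = +-identityʳ 0#

  coeff-pair : ∀ a b α γ β → coeff ((a , α) ∷ (b , γ) ∷ []) β ≈ coeffTerm a α β + coeffTerm b γ β
  coeff-pair a b α γ β = trans (coeff-cons a α _ β) (+-congˡ (trans (coeff-cons b γ [] β) (+-identityʳ _)))

  coeff-++ : ∀ f g β → coeff (f ++ g) β ≈ coeff f β + coeff g β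
  coeff-++ [] g β = sym (+-identityˡ _)
  coeff-++ ((d , α) ∷ f) g β = begin
    coeff ((d , α) ∷ (f ++ g)) β              ≈⟨ coeff-cons d α (f ++ g) β ⟩
    coeffTerm d α β + coeff (f ++ g) β        ≈⟨ +-congˡ (coeff-++ f g β) ⟩
    coeffTerm d α β + (coeff f β + coeff g β) ≈⟨ sym (+-assoc _ _ _) ⟩
    (coeffTerm d α β + coeff f β) + coeff g β ≈⟨ +-congʳ (sym (coeff-cons d α f β)) ⟩
    coeff ((d , α) ∷ f) β + coeff g β ∎

  eval-cons : ∀ d α f x → eval ((d , α) ∷ f) x ≈ d * monValue x α + eval f x
  eval-cons d α f x = +-congʳ (*-congˡ (evalMon≈monValue x α))

  eval-++ : ∀ f g x → eval (f ++ g) x ≈ eval f x + eval g x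
  eval-++ [] g x = sym (+-identityˡ _)
  eval-++ ((d , α) ∷ f) g x = trans (+-congˡ (eval-++ f g x)) (sym (+-assoc _ _ _))

  eval-map : ∀ c α (g : Poly) x →
    eval (List.map (λ { (d , β) → (c * d , α +ᵐ β) }) g) x ≈ (c * monValue x α) * eval g x
  eval-map c α [] x = sym (zeroʳ _)
  eval-map c α ((d , β) ∷ g) x = begin
    (c * d) * evalMon x (α +ᵐ β) + eval (List.map _ g) x
      ≈⟨ +-cong (*-congˡ (trans (evalMon≈monValue x (α +ᵐ β)) (monValue-+ᵐ x α β))) (eval-map c α g x) ⟩
    (c * d) * (monValue x α * monValue x β) + (c * monValue x α) * eval g x
      ≈⟨ +-congʳ (trans (*-interchange _ _ _ _) (*-congˡ (*-congˡ (sym (evalMon≈monValue x β))))) ⟩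
    (c * monValue x α) * (d * evalMon x β) + (c * monValue x α) * eval g x
      ≈⟨ sym (distribˡ _ _ _) ⟩
    (c * monValue x α) * eval ((d , β) ∷ g) x ∎

  eval-* : ∀ f g x → eval (f *ₚ g) x ≈ eval f x * eval g x
  eval-* [] g x = sym (zeroˡ _)
  eval-* ((c , α) ∷ f) g x = begin
    eval (List.map _ g ++ (f *ₚ g)) x                   ≈⟨ eval-++ (List.map _ g) (f *ₚ g) x ⟩
    eval (List.map _ g) x + eval (f *ₚ g) x             ≈⟨ +-cong (eval-map c α g x) (eval-* f g x) ⟩
    (c * monValue x α) * eval g x + eval f x * eval g x ≈⟨ sym (distribʳ _ _ _) ⟩
    (c * monValue x α + eval f x) * eval g x            ≈⟨ *-congʳ (sym (eval-cons c α f x)) ⟩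
    eval ((c , α) ∷ f) x * eval g x ∎

  ExpInBox : ℕ → Mon m → Set
  ExpInBox n β = ∃[ β₀ ] (toExp {n} β₀ ≡ β)

  PolyInBox : ℕ → Poly → Set
  PolyInBox n f = All (λ term → ExpInBox n (proj₂ term)) f

  ExpInBox-lift : ∀ {k n n'} {β : Mon k} → n ≤ n' → ∃[ β₀ ] (toExp {n} β₀ ≡ β) → ∃[ β₁ ] (toExp {n'} β₁ ≡ β)
  ExpInBox-lift {β = []} le ([] , e) = [] , e
  ExpInBox-lift {β = b ∷ β} le (i ∷ β₀ , e) with ExpInBox-lift le (β₀ , VecP.∷-injectiveʳ e)
  ... | β₁ , e′ = Fin.inject≤ i le ∷ β₁ ,
                  ≡.cong₂ _∷_ (≡.trans (FinP.toℕ-inject≤ i le) (VecP.∷-injectiveˡ e)) e′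

  ExpInBox-exists : ∀ {k} (β : Mon k) → ∃[ n ] ∃[ β₀ ] (toExp {n} β₀ ≡ β)
  ExpInBox-exists [] = 0 , [] , ≡.refl
  ExpInBox-exists (b ∷ β) with ExpInBox-exists β
  ... | n , β₀ , e with ExpInBox-lift {n' = suc b ⊔ n} (NP.m≤n⊔m (suc b) n) (β₀ , e)
  ... | β₁ , e′ = suc b ⊔ n , Fin.fromℕ< (NP.m≤m⊔n (suc b) n) ∷ β₁ , ≡.cong₂ _∷_ (FinP.toℕ-fromℕ< _) e′

  PolyInBox-lift : ∀ {n n'} {f} → n ≤ n' → PolyInBox n f → PolyInBox n' f
  PolyInBox-lift le [] = []
  PolyInBox-lift le (r ∷ b) = ExpInBox-lift le r ∷ PolyInBox-lift le b

  PolyInBox-exists : ∀ f → ∃[ n ] PolyInBox n f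
  PolyInBox-exists [] = 0 , []
  PolyInBox-exists ((d , β) ∷ f) with ExpInBox-exists β | PolyInBox-exists f
  ... | n₁ , r | n₂ , b = n₁ ⊔ n₂ , ExpInBox-lift (NP.m≤m⊔n n₁ n₂) r ∷ PolyInBox-lift (NP.m≤n⊔m n₁ n₂) b

  support-in-box : ∀ {n} f β → PolyInBox n f → ¬ coeff f β ≈ 0# → ExpInBox n β
  support-in-box [] β b nz = ⊥-elim (nz refl)
  support-in-box ((d , α) ∷ f) β ((α₀ , e) ∷ b) nz with VecP.≡-dec ℕ._≟_ α β
  ... | yes α≡β = α₀ , ≡.trans e α≡β
  ... | no _ = support-in-box f β b nz

  termSum : (Mon m → Carrier) → Poly → Carrier
  termSum h [] = 0#
  termSum h ((d , β) ∷ f) = d * h β + termSum h f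

  -- normal form: a term sum only depends on the coefficients of f
  termSum-as-ΣBox : ∀ {n} (h : Mon m → Carrier) f → PolyInBox n f →
                    termSum h f ≈ ΣBox n m (λ β → coeff f (toExp β) * h (toExp β))
  termSum-as-ΣBox {n} h [] b = sym (ΣBox-≈0 n m (λ β → zeroˡ _))
  termSum-as-ΣBox {n} h ((d , α) ∷ f) ((α₀ , e) ∷ b) = begin
    d * h α + termSum h f
      ≈⟨ +-cong (sym single-term) (termSum-as-ΣBox h f b) ⟩
    ΣBox n m (λ β → coeffTerm d α (toExp β) * h (toExp β)) + ΣBox n m (λ β → coeff f (toExp β) * h (toExp β))
      ≈⟨ sym (ΣBox-+ n m _ _) ⟩
    ΣBox n m (λ β → coeffTerm d α (toExp β) * h (toExp β) + coeff f (toExp β) * h (toExp β))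
      ≈⟨ ΣBox-cong n m (λ β → trans (sym (distribʳ _ _ _)) (*-congʳ (sym (coeff-cons d α f (toExp β))))) ⟩
    ΣBox n m (λ β → coeff ((d , α) ∷ f) (toExp β) * h (toExp β)) ∎
    where
    single-term : ΣBox n m (λ β → coeffTerm d α (toExp β) * h (toExp β)) ≈ d * h α
    single-term = trans (ΣBox-single n m α₀ _ (λ β β≢α₀ → trans (*-congʳ (coeffTerm-other d α (toExp β)
                    (λ p → β≢α₀ (toExp-injective β α₀ (≡.trans (≡.sym p) (≡.sym e)))))) (zeroˡ _)))
                  (≡.subst (λ γ → coeffTerm d α γ * h γ ≈ d * h α) (≡.sym e) (*-congʳ (coeffTerm-same d α)))

  eval-as-termSum : ∀ f x → eval f x ≈ termSum (monValue x) f
  eval-as-termSum [] x = refl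
  eval-as-termSum ((d , α) ∷ f) x = trans (eval-cons d α f x) (+-congˡ (eval-as-termSum f x))

  eval-as-ΣBox : ∀ {n} f x → PolyInBox n f → eval f x ≈ ΣBox n m (λ β → coeff f (toExp β) * monValue x (toExp β))
  eval-as-ΣBox f x b = trans (eval-as-termSum f x) (termSum-as-ΣBox (monValue x) f b)

  eval-respects-≐ : ∀ f g → f ≐ g → ∀ x → eval f x ≈ eval g x
  eval-respects-≐ f g f≐g x with PolyInBox-exists f | PolyInBox-exists g
  ... | n₁ , b₁ | n₂ , b₂ = begin
    eval f x ≈⟨ eval-as-ΣBox f x (PolyInBox-lift (NP.m≤m⊔n n₁ n₂) b₁) ⟩
    ΣBox (n₁ ⊔ n₂) m (λ β → coeff f (toExp β) * monValue x (toExp β)) ≈⟨ ΣBox-cong (n₁ ⊔ n₂) m (λ β → *-congʳ (f≐g (toExp β))) ⟩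
    ΣBox (n₁ ⊔ n₂) m (λ β → coeff g (toExp β) * monValue x (toExp β)) ≈⟨ sym (eval-as-ΣBox g x (PolyInBox-lift (NP.m≤n⊔m n₁ n₂) b₂)) ⟩
    eval g x ∎


module TermOrderFacts {m : ℕ} (ord : TermOrder m) where
  open TermOrder ord public
  module STO = IsStrictTotalOrder isSTO

  +ᵐ-comm : ∀ {k} (α β : Mon k) → α +ᵐ β ≡ β +ᵐ α
  +ᵐ-comm [] [] = ≡.refl
  +ᵐ-comm (a ∷ α) (b ∷ β) = ≡.cong₂ _∷_ (NP.+-comm a b) (+ᵐ-comm α β)

  0+ᵐ : ∀ {k} (α : Mon k) → 0ᵐ +ᵐ α ≡ α
  0+ᵐ [] = ≡.refl
  0+ᵐ (a ∷ α) = ≡.cong (a ∷_) (0+ᵐ α)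

  -- γ < 0 would give the infinite descending chain 0 > γ > 2γ > 3γ > …
  ≮0ᵐ : ∀ γ → ¬ (γ < 0ᵐ)
  ≮0ᵐ γ γ<0 = descend 0ᵐ (wf 0ᵐ) (≡.subst (_< 0ᵐ) (≡.sym (0+ᵐ γ)) γ<0)
    where
    descend : ∀ x → Acc _<_ x → ¬ ((x +ᵐ γ) < x)
    descend x (acc rs) lt = descend (x +ᵐ γ) (rs lt) (mono _ _ γ lt)

  0ᵐ≤ : ∀ γ → 0ᵐ ≤ γ
  0ᵐ≤ γ with STO.compare 0ᵐ γ
  ... | tri< 0<γ _ _ = inj₁ 0<γ
  ... | tri≈ _ 0≡γ _ = inj₂ 0≡γ
  ... | tri> _ _ γ<0 = ⊥-elim (≮0ᵐ γ γ<0)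

  _-ᵐ_ : ∀ {k} → Mon k → Mon k → Mon k
  _-ᵐ_ = zipWith ℕ._∸_

  ∣⇒+ : ∀ {k} (α β : Mon k) → α ∣ᵐ β → α +ᵐ (β -ᵐ α) ≡ β
  ∣⇒+ [] [] d = ≡.refl
  ∣⇒+ (a ∷ α) (b ∷ β) d = ≡.cong₂ _∷_ (NP.m+[n∸m]≡n (d zero)) (∣⇒+ α β (λ i → d (suc i)))

  -- α ∣ β means β = α + (β - α) ≥ α + 0
  ∣⇒≤ : ∀ α β → α ∣ᵐ β → α ≤ β
  ∣⇒≤ α β d with 0ᵐ≤ (β -ᵐ α)
  ... | inj₂ e = inj₂ (≡.trans (≡.sym (≡.trans (≡.cong (α +ᵐ_) (≡.sym e)) (≡.trans (+ᵐ-comm α 0ᵐ) (0+ᵐ α)))) (∣⇒+ α β d))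
  ... | inj₁ lt = inj₁ (≡.subst₂ _<_ (0+ᵐ α) (≡.trans (+ᵐ-comm (β -ᵐ α) α) (∣⇒+ α β d)) (mono _ _ α lt))

  ∣≢⇒< : ∀ α β → α ∣ᵐ β → α ≢ β → α < β
  ∣≢⇒< α β d ne with ∣⇒≤ α β d
  ... | inj₁ lt = lt
  ... | inj₂ e = ⊥-elim (ne e)

  <⇒≱ : ∀ {α β} → α < β → ¬ (β ≤ α)
  <⇒≱ lt (inj₁ gt) = STO.asym lt gt
  <⇒≱ lt (inj₂ e) = STO.irrefl (≡.sym e) lt

  ≤-trans-< : ∀ {α β γ} → α ≤ β → β < γ → α < γ
  ≤-trans-< (inj₁ a) b = STO.trans a b
  ≤-trans-< (inj₂ ≡.refl) b = b


-- Reduction of exponents modulo y^q = y: an exponent e ≥ 1 is replaced by the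
-- unique e' ∈ [1, q-1] with e ≡ e' mod (q-1), and 0 stays 0.  By Fermat this
-- does not change the value of a monomial at any point, and it preserves the
-- support.
module ExponentReduction {q : ℕ} (F : FiniteField q) (m : ℕ) where
  open import Data.Nat using (_≤_; _<_)
  open PolynomialCalculus F m public

  q-2 : ℕ
  q-2 = proj₁ q≥2

  q-1 : ℕ
  q-1 = suc q-2

  q≡1+[q-1] : q ≡ suc q-1
  q≡1+[q-1] = proj₂ q≥2

  reduceExp : ℕ → ℕ
  reduceExp zero = 0
  reduceExp (suc n) = suc (n % q-1)

  reduceExp<q : ∀ e → reduceExp e < q
  reduceExp<q zero = ≡.subst (0 <_) (≡.sym q≡1+[q-1]) (s≤s z≤n)
  reduceExp<q (suc n) = ≡.subst (suc (n % q-1) <_) (≡.sym q≡1+[q-1]) (s≤s (m%n<n n q-1))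

  reduceExpFin : ℕ → Fin q
  reduceExpFin e = Fin.fromℕ< (reduceExp<q e)

  toℕ-reduceExpFin : ∀ e → toℕ (reduceExpFin e) ≡ reduceExp e
  toℕ-reduceExpFin e = FinP.toℕ-fromℕ< _

  reduceExp-small : ∀ e → e < q → reduceExp e ≡ e
  reduceExp-small zero lt = ≡.refl
  reduceExp-small (suc n) lt = ≡.cong suc (m<n⇒m%n≡m (NP.≤-pred (≡.subst (suc n <_) q≡1+[q-1] lt)))

  reduceExp-≤ : ∀ e → reduceExp e ≤ e
  reduceExp-≤ zero = z≤n
  reduceExp-≤ (suc n) = s≤s (m%n≤m n q-1)

  fermat-suc : ∀ x → pow x (suc q-1) ≈ x
  fermat-suc x = ≡.subst (λ k → pow x k ≈ x) q≡1+[q-1] (fermat x)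

  x*x^[k*[q-1]]≈x : ∀ x k → x * pow x (k ℕ.* q-1) ≈ x
  x*x^[k*[q-1]]≈x x zero = *-identityʳ x
  x*x^[k*[q-1]]≈x x (suc k) = begin
    x * pow x (q-1 ℕ.+ k ℕ.* q-1)       ≈⟨ *-congˡ (pow-+ x q-1 (k ℕ.* q-1)) ⟩
    x * (pow x q-1 * pow x (k ℕ.* q-1)) ≈⟨ sym (*-assoc _ _ _) ⟩
    pow x (suc q-1) * pow x (k ℕ.* q-1) ≈⟨ *-congʳ (fermat-suc x) ⟩
    x * pow x (k ℕ.* q-1)               ≈⟨ x*x^[k*[q-1]]≈x x k ⟩
    x ∎

  pow-reduceExp : ∀ x e → pow x e ≈ pow x (reduceExp e)
  pow-reduceExp x zero = refl
  pow-reduceExp x (suc n) = begin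
    x * pow x n ≡⟨ ≡.cong (λ k → x * pow x k) (m≡m%n+[m/n]*n n q-1) ⟩
    x * pow x (n % q-1 ℕ.+ (n / q-1) ℕ.* q-1) ≈⟨ *-congˡ (pow-+ x (n % q-1) ((n / q-1) ℕ.* q-1)) ⟩
    x * (pow x (n % q-1) * pow x ((n / q-1) ℕ.* q-1)) ≈⟨ x*[y*z]≈y*[x*z] _ _ _ ⟩
    pow x (n % q-1) * (x * pow x ((n / q-1) ℕ.* q-1)) ≈⟨ *-congˡ (x*x^[k*[q-1]]≈x x (n / q-1)) ⟩
    pow x (n % q-1) * x ≈⟨ *-comm _ _ ⟩
    x * pow x (n % q-1) ∎

  reduceMon : ∀ {k} → Mon k → Vec (Fin q) k
  reduceMon = Vec.map reduceExpFin

  toExp-reduceMon : ∀ {k} (β : Mon k) → toExp (reduceMon β) ≡ Vec.map reduceExp β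
  toExp-reduceMon [] = ≡.refl
  toExp-reduceMon (b ∷ β) = ≡.cong₂ _∷_ (toℕ-reduceExpFin b) (toExp-reduceMon β)

  monValue-reduceExp : ∀ {k} (x : Vec Carrier k) (β : Mon k) → monValue x β ≈ monValue x (Vec.map reduceExp β)
  monValue-reduceExp [] [] = refl
  monValue-reduceExp (a ∷ x) (b ∷ β) = *-cong (pow-reduceExp a b) (monValue-reduceExp x β)

  monValue-reduceMon : ∀ {k} (x : Vec Carrier k) (β : Mon k) → monValue x β ≈ monValue x (toExp (reduceMon β))
  monValue-reduceMon x β = trans (monValue-reduceExp x β) (reflexive (≡.cong (monValue x) (≡.sym (toExp-reduceMon β))))

  supp-reduceExp : ∀ {k} (β : Mon k) → supp (Vec.map reduceExp β) ≡ supp β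
  supp-reduceExp [] = ≡.refl
  supp-reduceExp (zero ∷ β) = supp-reduceExp β
  supp-reduceExp (suc b ∷ β) = ≡.cong suc (supp-reduceExp β)

  supp-reduceMon : ∀ {k} (β : Mon k) → supp (toExp (reduceMon β)) ≡ supp β
  supp-reduceMon β = ≡.trans (≡.cong supp (toExp-reduceMon β)) (supp-reduceExp β)

  Standard : ∀ {k} → Mon k → Set
  Standard {k} β = ∀ (i : Fin k) → lookup β i < q

  reduceExp-Standard : ∀ {k} (β : Mon k) → Standard β → Vec.map reduceExp β ≡ β
  reduceExp-Standard [] s = ≡.refl
  reduceExp-Standard (b ∷ β) s = ≡.cong₂ _∷_ (reduceExp-small b (s zero)) (reduceExp-Standard β (λ i → s (suc i)))

  reduceMon-Standard : ∀ {k} (β : Mon k) → Standard β → toExp (reduceMon β) ≡ β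
  reduceMon-Standard β s = ≡.trans (toExp-reduceMon β) (reduceExp-Standard β s)

  reduceExp-∣ : ∀ {k} (β : Mon k) → Vec.map reduceExp β ∣ᵐ β
  reduceExp-∣ (b ∷ β) zero = reduceExp-≤ b
  reduceExp-∣ (b ∷ β) (suc i) = reduceExp-∣ β i

  reduceMon-∣ : ∀ {k} (β : Mon k) → toExp (reduceMon β) ∣ᵐ β
  reduceMon-∣ β = ≡.subst (_∣ᵐ β) (≡.sym (toExp-reduceMon β)) (reduceExp-∣ β)


-- Truncation at support t: reduce all exponents modulo y^q = y and drop the
-- terms that involve more than t variables.  On Q_t this does not change the
-- value of a polynomial (reduction is invisible by Fermat, and the dropped
-- monomials vanish on Q_t by the pigeonhole lemma).  So if f vanishes on Q_t,
-- its truncation satisfies the hypotheses of the key lemma and is zero.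
module Truncation {q : ℕ} (F : FiniteField q) (m : ℕ) where
  open ExponentReduction F m public

  module Truncate (t : ℕ) where
    truncCoeff : Mon m → Carrier → Carrier
    truncCoeff β d with supp β ℕ.≤? t
    ... | yes _ = d
    ... | no _ = 0#

    truncCoeff-low : ∀ β d → supp β ℕ.≤ t → truncCoeff β d ≡ d
    truncCoeff-low β d low with supp β ℕ.≤? t
    ... | yes _ = ≡.refl
    ... | no high = ⊥-elim (high low)

    truncCoeff-high : ∀ β d → ¬ supp β ℕ.≤ t → truncCoeff β d ≡ 0#
    truncCoeff-high β d high with supp β ℕ.≤? t
    ... | yes low = ⊥-elim (high low)
    ... | no _ = ≡.refl

    truncTerm : Carrier × Mon m → Carrier × Mon m
    truncTerm (d , β) = truncCoeff β d , toExp (reduceMon β)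

    truncate : Poly → Poly
    truncate f = List.map truncTerm f

    truncate-inBox : ∀ f → PolyInBox q (truncate f)
    truncate-inBox [] = []
    truncate-inBox ((d , β) ∷ f) = (reduceMon β , ≡.refl) ∷ truncate-inBox f

    truncate-eval : ∀ f x → wt x ℕ.≤ t → eval (truncate f) x ≈ eval f x
    truncate-eval [] x wt≤t = refl
    truncate-eval ((d , β) ∷ f) x wt≤t =
      trans (eval-cons (truncCoeff β d) (toExp (reduceMon β)) (truncate f) x)
        (trans (+-cong (term (supp β ℕ.≤? t)) (truncate-eval f x wt≤t)) (sym (eval-cons d β f x)))
      where
      term : Dec (supp β ℕ.≤ t) → truncCoeff β d * monValue x (toExp (reduceMon β)) ≈ d * monValue x β
      term (yes low) = trans (*-congʳ (reflexive (truncCoeff-low β d low))) (*-congˡ (sym (monValue-reduceMon x β)))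
      term (no high) = trans (*-congʳ (reflexive (truncCoeff-high β d high))) (trans (zeroˡ _)
        (sym (trans (*-congˡ (monValue≈0-if-wt<supp x β (NP.≤-<-trans wt≤t (NP.≰⇒> high)))) (zeroʳ d))))

    truncate-highSupport : ∀ f (γ : Mon m) → t ℕ.< supp γ → coeff (truncate f) γ ≈ 0#
    truncate-highSupport [] γ lt = refl
    truncate-highSupport ((d , β) ∷ f) γ lt =
      trans (coeff-cons (truncCoeff β d) (toExp (reduceMon β)) (truncate f) γ)
        (trans (+-cong (term (VecP.≡-dec ℕ._≟_ (toExp (reduceMon β)) γ) (supp β ℕ.≤? t))
                       (truncate-highSupport f γ lt))
               (+-identityˡ 0#))
      where
      term : Dec (toExp (reduceMon β) ≡ γ) → Dec (supp β ℕ.≤ t) →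
             coeffTerm (truncCoeff β d) (toExp (reduceMon β)) γ ≈ 0#
      term (no β′≢γ) _ = coeffTerm-other _ _ _ β′≢γ
      term (yes β′≡γ) (no high) = ≡.subst (λ c → coeffTerm c (toExp (reduceMon β)) γ ≈ 0#)
                                    (≡.sym (truncCoeff-high β d high)) (coeffTerm-0# (toExp (reduceMon β)) γ)
      term (yes β′≡γ) (yes low) = ⊥-elim (NP.<⇒≱ lt
        (≡.subst (ℕ._≤ t) (≡.trans (≡.sym (supp-reduceMon β)) (≡.cong supp β′≡γ)) low))

    truncate-vanishes : ∀ f → (∀ x → wt x ℕ.≤ t → eval f x ≈ 0#) → ∀ γ → coeff (truncate f) γ ≈ 0#
    truncate-vanishes f vanish γ with coeff (truncate f) γ ≟ 0#
    ... | yes γ≈0 = γ≈0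
    ... | no γ≉0 with support-in-box (truncate f) γ (truncate-inBox f) γ≉0
    ...   | γ₀ , e = ⊥-elim (γ≉0 (≡.subst (λ z → coeff (truncate f) z ≈ 0#) e (coeffs≈0 γ₀)))
      where
      coeffs≈0 : ∀ γ → coeff (truncate f) (toExp γ) ≈ 0#
      coeffs≈0 = lowSupportVanishing⇒coeffs≈0 m t (λ γ → coeff (truncate f) (toExp γ))
        ( (λ γ lt → truncate-highSupport f (toExp γ) lt)
        , (λ x wt≤t → trans (sym (eval-as-ΣBox (truncate f) x (truncate-inBox f)))
                        (trans (truncate-eval f x wt≤t) (vanish x wt≤t))))

    selects : Mon m → Mon m → Carrier
    selects α β with supp β ℕ.≤? t | VecP.≡-dec ℕ._≟_ (toExp (reduceMon β)) α
    ... | yes _ | yes _ = 1#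
    ... | _ | _ = 0#

    selects-hit : ∀ α β → supp β ℕ.≤ t → toExp (reduceMon β) ≡ α → selects α β ≡ 1#
    selects-hit α β low e with supp β ℕ.≤? t | VecP.≡-dec ℕ._≟_ (toExp (reduceMon β)) α
    ... | yes _ | yes _ = ≡.refl
    ... | no high | _ = ⊥-elim (high low)
    ... | yes _ | no ne = ⊥-elim (ne e)

    selects-highSupport : ∀ α β → ¬ supp β ℕ.≤ t → selects α β ≡ 0#
    selects-highSupport α β high with supp β ℕ.≤? t | VecP.≡-dec ℕ._≟_ (toExp (reduceMon β)) α
    ... | yes low | _ = ⊥-elim (high low)
    ... | no _ | yes _ = ≡.refl
    ... | no _ | no _ = ≡.refl

    selects-other : ∀ α β → toExp (reduceMon β) ≢ α → selects α β ≡ 0#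
    selects-other α β ne with supp β ℕ.≤? t | VecP.≡-dec ℕ._≟_ (toExp (reduceMon β)) α
    ... | _ | yes e = ⊥-elim (ne e)
    ... | yes _ | no _ = ≡.refl
    ... | no _ | no _ = ≡.refl

    truncate-coeff : ∀ f α → coeff (truncate f) α ≈ termSum (selects α) f
    truncate-coeff [] α = refl
    truncate-coeff ((d , β) ∷ f) α = trans (coeff-cons (truncCoeff β d) β′ (truncate f) α)
        (+-cong (term (supp β ℕ.≤? t) (VecP.≡-dec ℕ._≟_ β′ α)) (truncate-coeff f α))
      where
      β′ = toExp (reduceMon β)
      term : Dec (supp β ℕ.≤ t) → Dec (β′ ≡ α) → coeffTerm (truncCoeff β d) β′ α ≈ d * selects α β
      term (yes low) (yes e) = begin
        coeffTerm (truncCoeff β d) β′ α ≡⟨ ≡.cong₂ (λ c γ → coeffTerm c β′ γ) (truncCoeff-low β d low) (≡.sym e) ⟩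
        coeffTerm d β′ β′               ≈⟨ coeffTerm-same d β′ ⟩
        d                               ≈⟨ sym (*-identityʳ d) ⟩
        d * 1#                          ≡⟨ ≡.cong (d *_) (≡.sym (selects-hit α β low e)) ⟩
        d * selects α β ∎
      term _ (no ne) = trans (coeffTerm-other _ _ _ ne) (sym (trans (*-congˡ (reflexive (selects-other α β ne))) (zeroʳ d)))
      term (no high) (yes _) = trans (reflexive (≡.cong (λ c → coeffTerm c β′ α) (truncCoeff-high β d high)))
         (trans (coeffTerm-0# β′ α) (sym (trans (*-congˡ (reflexive (selects-highSupport α β high))) (zeroʳ d))))


-- The leading-monomial lemma: if f ∈ I(Q_t) is nonzero, its leading monomial α
-- is not standard or involves more than t variables.  Otherwise the coefficient
-- of y^α in the truncation of f (which is 0) would be coeff f α itself: every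
-- other β reducing to α is a proper multiple of α, hence larger than the
-- leading monomial, and so has coefficient 0 in f.
module LeadingMonomials {q : ℕ} (F : FiniteField q) (m : ℕ) where
  open Truncation F m public

  no-standard-lowSupport-LM : ∀ t (ord : TermOrder m) f α → InVanishingIdealQ t f → IsLM ord f α →
                              Standard α → supp α ℕ.≤ t → ⊥
  no-standard-lowSupport-LM t ord f α vanish (α≉0 , α-max) α-std α-low = α≉0 coeffα≈0
    where
    open Truncate t
    open TermOrderFacts ord using (∣≢⇒<; <⇒≱)
    box = PolyInBox-exists f
    N = proj₁ box
    α₀ = proj₁ (support-in-box f α (proj₂ box) α≉0)
    α₀≡α = proj₂ (support-in-box f α (proj₂ box) α≉0)
    others : ∀ β → β ≢ α₀ → coeff f (toExp β) * selects α (toExp β) ≈ 0#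
    others β β≢α₀ with coeff f (toExp β) ≟ 0#
    ... | yes β≈0 = trans (*-congʳ β≈0) (zeroˡ _)
    ... | no β≉0 = by-cases (supp (toExp β) ℕ.≤? t) (VecP.≡-dec ℕ._≟_ (toExp (reduceMon (toExp β))) α)
      where
      by-cases : Dec (supp (toExp β) ℕ.≤ t) → Dec (toExp (reduceMon (toExp β)) ≡ α) →
                 coeff f (toExp β) * selects α (toExp β) ≈ 0#
      by-cases (yes _) (yes reduces-to-α) = ⊥-elim (<⇒≱
        (∣≢⇒< α (toExp β) (≡.subst (_∣ᵐ toExp β) reduces-to-α (reduceMon-∣ (toExp β)))
               (λ p → β≢α₀ (toExp-injective β α₀ (≡.trans (≡.sym p) (≡.sym α₀≡α)))))
        (α-max (toExp β) β≉0))
      by-cases _ (no ne) = trans (*-congˡ (reflexive (selects-other α (toExp β) ne))) (zeroʳ _)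
      by-cases (no high) _ = trans (*-congˡ (reflexive (selects-highSupport α (toExp β) high))) (zeroʳ _)
    coeffα≈0 : coeff f α ≈ 0#
    coeffα≈0 = begin
      coeff f α                                  ≈⟨ sym (*-identityʳ _) ⟩
      coeff f α * 1#                             ≡⟨ ≡.cong (coeff f α *_) (≡.sym (selects-hit α α α-low (reduceMon-Standard α α-std))) ⟩
      coeff f α * selects α α                    ≡⟨ ≡.cong (λ γ → coeff f γ * selects α γ) (≡.sym α₀≡α) ⟩
      coeff f (toExp α₀) * selects α (toExp α₀)  ≈⟨ sym (ΣBox-single N m α₀ _ others) ⟩
      ΣBox N m (λ β → coeff f (toExp β) * selects α (toExp β)) ≈⟨ sym (termSum-as-ΣBox (selects α) f (proj₂ box)) ⟩
      termSum (selects α) f                      ≈⟨ sym (truncate-coeff f α) ⟩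
      coeff (truncate f) α                       ≈⟨ truncate-vanishes f vanish α ⟩
      0# ∎


-- A combination over S is a list of products u · g with
-- g ∈ S; its value is their sum.  Collecting the cofactors of equal generators
-- turns any combination into a witness of the Defs notion f ∈⟨ S ⟩ (one
-- cofactor per element of S).
module IdealMembership {q : ℕ} (F : FiniteField q) (m : ℕ) where
  open LeadingMonomials F m public

  coeff-*-++ : ∀ u v s β → coeff ((u ++ v) *ₚ s) β ≈ coeff (u *ₚ s) β + coeff (v *ₚ s) β
  coeff-*-++ [] v s β = sym (+-identityˡ _)
  coeff-*-++ ((c , α) ∷ u) v s β = begin
    coeff (M ++ ((u ++ v) *ₚ s)) β ≈⟨ coeff-++ M ((u ++ v) *ₚ s) β ⟩
    coeff M β + coeff ((u ++ v) *ₚ s) β ≈⟨ +-congˡ (coeff-*-++ u v s β) ⟩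
    coeff M β + (coeff (u *ₚ s) β + coeff (v *ₚ s) β) ≈⟨ sym (+-assoc _ _ _) ⟩
    (coeff M β + coeff (u *ₚ s) β) + coeff (v *ₚ s) β ≈⟨ +-congʳ (sym (coeff-++ M (u *ₚ s) β)) ⟩
    coeff (M ++ (u *ₚ s)) β + coeff (v *ₚ s) β ∎
    where
    M = List.map (λ { (d , β) → (c * d , α +ᵐ β) }) s

  Combination : List Poly → Set
  Combination S = List (Σ Poly λ u → Σ Poly λ g → g ∈ S)

  combValue : ∀ {S} → Combination S → Poly
  combValue [] = []
  combValue ((u , g , _) ∷ L) = (u *ₚ g) ++ combValue L

  combValue-++ : ∀ {S} (L₁ L₂ : Combination S) → combValue (L₁ ++ L₂) ≐ (combValue L₁ ++ combValue L₂)
  combValue-++ [] L₂ β = refl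
  combValue-++ ((u , g , p) ∷ L₁) L₂ β = begin
    coeff ((u *ₚ g) ++ combValue (L₁ ++ L₂)) β ≈⟨ coeff-++ (u *ₚ g) _ β ⟩
    coeff (u *ₚ g) β + coeff (combValue (L₁ ++ L₂)) β ≈⟨ +-congˡ (combValue-++ L₁ L₂ β) ⟩
    coeff (u *ₚ g) β + coeff (combValue L₁ ++ combValue L₂) β ≈⟨ +-congˡ (coeff-++ (combValue L₁) _ β) ⟩
    coeff (u *ₚ g) β + (coeff (combValue L₁) β + coeff (combValue L₂) β) ≈⟨ sym (+-assoc _ _ _) ⟩
    (coeff (u *ₚ g) β + coeff (combValue L₁) β) + coeff (combValue L₂) β ≈⟨ +-congʳ (sym (coeff-++ (u *ₚ g) (combValue L₁) β)) ⟩
    coeff ((u *ₚ g) ++ combValue L₁) β + coeff (combValue L₂) β ≈⟨ sym (coeff-++ ((u *ₚ g) ++ combValue L₁) (combValue L₂) β) ⟩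
    coeff (((u *ₚ g) ++ combValue L₁) ++ combValue L₂) β ∎

  combRelabel : ∀ {S T : List Poly} → (∀ {g : Poly} → g ∈ S → g ∈ T) → Combination S → Combination T
  combRelabel h [] = []
  combRelabel h ((u , g , p) ∷ L) = (u , g , h p) ∷ combRelabel h L

  combRelabel-value : ∀ {S T : List Poly} (h : ∀ {g : Poly} → g ∈ S → g ∈ T) (L : Combination S) → combValue (combRelabel h L) ≡ combValue L
  combRelabel-value h [] = ≡.refl
  combRelabel-value h ((u , g , p) ∷ L) = ≡.cong ((u *ₚ g) ++_) (combRelabel-value h L)

  zeroPolys : ℕ → List Poly
  zeroPolys zero = []
  zeroPolys (suc n) = [] ∷ zeroPolys n

  addAt : ∀ {g : Poly} {S : List Poly} → g ∈ S → List Poly → Poly → List Poly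
  addAt (here _) (h0 ∷ hs) u = (u ++ h0) ∷ hs
  addAt (there p) (h0 ∷ hs) u = h0 ∷ addAt p hs u
  addAt _ [] u = []

  addAt-len : ∀ {g S} (p : g ∈ S) hs u → length hs ≡ length S → length (addAt p hs u) ≡ length S
  addAt-len (here _) (h0 ∷ hs) u e = e
  addAt-len {S = _ ∷ S} (there p) (h0 ∷ hs) u e = ≡.cong suc (addAt-len p hs u (NP.suc-injective e))

  linComb : List Poly → List Poly → Poly
  linComb hs S = sumₚ (List.zipWith _*ₚ_ hs S)

  addAt-val : ∀ {g S} (p : g ∈ S) hs u → length hs ≡ length S → ∀ β →
              coeff (linComb (addAt p hs u) S) β ≈ coeff (u *ₚ g) β + coeff (linComb hs S) β
  addAt-val {S = s ∷ S} (here ≡.refl) (h0 ∷ hs) u e β = begin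
    coeff (((u ++ h0) *ₚ s) ++ linComb hs S) β ≈⟨ coeff-++ ((u ++ h0) *ₚ s) _ β ⟩
    coeff ((u ++ h0) *ₚ s) β + coeff (linComb hs S) β ≈⟨ +-congʳ (coeff-*-++ u h0 s β) ⟩
    (coeff (u *ₚ s) β + coeff (h0 *ₚ s) β) + coeff (linComb hs S) β ≈⟨ +-assoc _ _ _ ⟩
    coeff (u *ₚ s) β + (coeff (h0 *ₚ s) β + coeff (linComb hs S) β) ≈⟨ +-congˡ (sym (coeff-++ (h0 *ₚ s) _ β)) ⟩
    coeff (u *ₚ s) β + coeff ((h0 *ₚ s) ++ linComb hs S) β ∎
  addAt-val {g} {S = s ∷ S} (there p) (h0 ∷ hs) u e β = begin
    coeff ((h0 *ₚ s) ++ linComb (addAt p hs u) S) β ≈⟨ coeff-++ (h0 *ₚ s) _ β ⟩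
    coeff (h0 *ₚ s) β + coeff (linComb (addAt p hs u) S) β ≈⟨ +-congˡ (addAt-val p hs u (NP.suc-injective e) β) ⟩
    coeff (h0 *ₚ s) β + (coeff (u *ₚ g) β + coeff (linComb hs S) β) ≈⟨ sym (+-assoc _ _ _) ⟩
    (coeff (h0 *ₚ s) β + coeff (u *ₚ g) β) + coeff (linComb hs S) β ≈⟨ +-congʳ (+-comm _ _) ⟩
    (coeff (u *ₚ g) β + coeff (h0 *ₚ s) β) + coeff (linComb hs S) β ≈⟨ +-assoc _ _ _ ⟩
    coeff (u *ₚ g) β + (coeff (h0 *ₚ s) β + coeff (linComb hs S) β) ≈⟨ +-congˡ (sym (coeff-++ (h0 *ₚ s) _ β)) ⟩
    coeff (u *ₚ g) β + coeff ((h0 *ₚ s) ++ linComb hs S) β ∎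

  cofactors : ∀ {S} → Combination S → List Poly
  cofactors {S} [] = zeroPolys (length S)
  cofactors ((u , g , p) ∷ L) = addAt p (cofactors L) u

  zeroPolys-length : ∀ n → length (zeroPolys n) ≡ n
  zeroPolys-length zero = ≡.refl
  zeroPolys-length (suc n) = ≡.cong suc (zeroPolys-length n)

  cofactors-length : ∀ {S} (L : Combination S) → length (cofactors L) ≡ length S
  cofactors-length {S} [] = zeroPolys-length (length S)
  cofactors-length ((u , g , p) ∷ L) = addAt-len p (cofactors L) u (cofactors-length L)

  zeroPolys-value : ∀ S β → coeff (linComb (zeroPolys (length S)) S) β ≈ 0#
  zeroPolys-value [] β = refl
  zeroPolys-value (s ∷ S) β = zeroPolys-value S β

  cofactors-value : ∀ {S} (L : Combination S) β → coeff (linComb (cofactors L) S) β ≈ coeff (combValue L) β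
  cofactors-value {S} [] β = zeroPolys-value S β
  cofactors-value ((u , g , p) ∷ L) β = trans (addAt-val p (cofactors L) u (cofactors-length L) β)
    (trans (+-congˡ (cofactors-value L β)) (sym (coeff-++ (u *ₚ g) _ β)))

  combination⇒∈⟨⟩ : ∀ {S} f (L : Combination S) → f ≐ combValue L → f ∈⟨ S ⟩
  combination⇒∈⟨⟩ f L e = cofactors L , (λ β → trans (e β) (sym (cofactors-value L β))) , cofactors-length L


-- First, each
-- monomial y^β is congruent modulo ⟨E_q[Y]⟩ to its reduction: lowering an
-- exponent βᵢ ≥ q by q - 1 differs from y^β by y^δ · (yᵢ^q - yᵢ).  Hence
-- f ≡ truncate f modulo ⟨E_q[Y]⟩ (truncation at support m only reduces), and
-- truncate f = 0 for f vanishing on F^m = Q_m.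
module FieldEquationIdeal {q : ℕ} (F : FiniteField q) (m : ℕ) where
  open IdealMembership F m public

  qExp : Fin m → Mon m
  qExp i = updateAt (0ᵐ {m}) i (λ _ → q)

  unitExp : Fin m → Mon m
  unitExp i = updateAt (0ᵐ {m}) i (λ _ → 1)

  fieldEq : Fin m → Poly
  fieldEq i = (1# , qExp i) ∷ (- 1# , unitExp i) ∷ []

  fieldEq∈Eq : ∀ i → fieldEq i ∈ Eq
  fieldEq∈Eq i = ∈-map⁺ _ (∈-allFin i)

  [b∸q]+1≡b∸[q-1] : ∀ b → q ℕ.≤ b → (b ∸ q) ℕ.+ 1 ≡ b ∸ q-1
  [b∸q]+1≡b∸[q-1] b q≤b = ≡.subst (λ k → (b ∸ k) ℕ.+ 1 ≡ b ∸ q-1) (≡.sym q≡1+[q-1])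
                            (lemma b (≡.subst (ℕ._≤ b) q≡1+[q-1] q≤b))
    where
    lemma : ∀ b → suc q-1 ℕ.≤ b → (b ∸ suc q-1) ℕ.+ 1 ≡ b ∸ q-1
    lemma (suc b') (s≤s le) = ≡.trans (NP.+-comm (b' ∸ q-1) 1) (≡.sym (NP.+-∸-assoc 1 le))

  reduceExp-∸[q-1] : ∀ b → q ℕ.≤ b → reduceExp (b ∸ q-1) ≡ reduceExp b
  reduceExp-∸[q-1] b q≤b = lemma b (≡.subst (ℕ._≤ b) q≡1+[q-1] q≤b)
    where
    lemma : ∀ b → suc q-1 ℕ.≤ b → reduceExp (b ∸ q-1) ≡ reduceExp b
    lemma (suc b') (s≤s le) = ≡.trans (≡.cong reduceExp (NP.+-∸-assoc 1 le)) (≡.cong suc (m≤n⇒[n∸m]%m≡n%m le))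

  ∸[q-1]< : ∀ b → q ℕ.≤ b → b ∸ q-1 ℕ.< b
  ∸[q-1]< b q≤b with ≡.subst (ℕ._≤ b) q≡1+[q-1] q≤b
  ... | s≤s {n = b'} _ = s≤s (NP.m∸n≤m b' q-2)

  totalDegree : ∀ {k} → Mon k → ℕ
  totalDegree [] = 0
  totalDegree (b ∷ β) = b ℕ.+ totalDegree β

  +0ᵐ : ∀ {k} (α : Mon k) → α +ᵐ 0ᵐ ≡ α
  +0ᵐ [] = ≡.refl
  +0ᵐ (a ∷ α) = ≡.cong₂ _∷_ (NP.+-identityʳ a) (+0ᵐ α)

  lowerByQ+qExp : ∀ {k} (β : Mon k) i → q ℕ.≤ lookup β i → updateAt β i (_∸ q) +ᵐ updateAt 0ᵐ i (λ _ → q) ≡ β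
  lowerByQ+qExp (b ∷ β) zero q≤b = ≡.cong₂ _∷_ (NP.m∸n+n≡m q≤b) (+0ᵐ β)
  lowerByQ+qExp (b ∷ β) (suc i) q≤b = ≡.cong₂ _∷_ (NP.+-identityʳ b) (lowerByQ+qExp β i q≤b)

  lowerByQ+unitExp : ∀ {k} (β : Mon k) i → q ℕ.≤ lookup β i →
                     updateAt β i (_∸ q) +ᵐ updateAt 0ᵐ i (λ _ → 1) ≡ updateAt β i (_∸ q-1)
  lowerByQ+unitExp (b ∷ β) zero q≤b = ≡.cong₂ _∷_ ([b∸q]+1≡b∸[q-1] b q≤b) (+0ᵐ β)
  lowerByQ+unitExp (b ∷ β) (suc i) q≤b = ≡.cong₂ _∷_ (NP.+-identityʳ b) (lowerByQ+unitExp β i q≤b)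

  reduceExp-lowerByQ-1 : ∀ {k} (β : Mon k) i → q ℕ.≤ lookup β i →
                         Vec.map reduceExp (updateAt β i (_∸ q-1)) ≡ Vec.map reduceExp β
  reduceExp-lowerByQ-1 (b ∷ β) zero q≤b = ≡.cong (_∷ Vec.map reduceExp β) (reduceExp-∸[q-1] b q≤b)
  reduceExp-lowerByQ-1 (b ∷ β) (suc i) q≤b = ≡.cong (reduceExp b ∷_) (reduceExp-lowerByQ-1 β i q≤b)

  lowerByQ-1-decreases : ∀ {k} (β : Mon k) i → q ℕ.≤ lookup β i →
                         totalDegree (updateAt β i (_∸ q-1)) ℕ.< totalDegree β
  lowerByQ-1-decreases (b ∷ β) zero q≤b = NP.+-monoˡ-< (totalDegree β) (∸[q-1]< b q≤b)
  lowerByQ-1-decreases (b ∷ β) (suc i) q≤b = NP.+-monoʳ-< b (lowerByQ-1-decreases β i q≤b)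

  ¬q≤⇒Standard : ∀ {k} (β : Mon k) → (∀ i → ¬ q ℕ.≤ lookup β i) → Standard β
  ¬q≤⇒Standard β small i = NP.≰⇒> (small i)

  _≡ModE_ : Mon m → Mon m → Set
  β ≡ModE γ = ∀ d → ∃[ L ] (((d , β) ∷ (- d , γ) ∷ []) ≐ combValue {Eq} L)

  ≡ModE-refl : ∀ β → β ≡ModE β
  ≡ModE-refl β d = [] , λ β' → trans (coeff-pair d (- d) β β β') (trans (+-comm _ _) (coeffTerm-cancel d β β'))

  ≡ModE-trans : ∀ {β γ δ} → β ≡ModE γ → γ ≡ModE δ → β ≡ModE δ
  ≡ModE-trans {β} {γ} {δ} β≡γ γ≡δ d with β≡γ d | γ≡δ d
  ... | L₁ , e₁ | L₂ , e₂ = L₁ ++ L₂ , λ β' → begin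
    coeff ((d , β) ∷ (- d , δ) ∷ []) β'
      ≈⟨ coeff-pair d (- d) β δ β' ⟩
    coeffTerm d β β' + coeffTerm (- d) δ β'
      ≈⟨ +-congˡ (trans (sym (+-identityˡ _)) (+-congʳ (sym (coeffTerm-cancel d γ β')))) ⟩
    coeffTerm d β β' + ((coeffTerm (- d) γ β' + coeffTerm d γ β') + coeffTerm (- d) δ β')
      ≈⟨ sym (+-regroup₄ _ _ _ _) ⟩
    (coeffTerm d β β' + coeffTerm (- d) γ β') + (coeffTerm d γ β' + coeffTerm (- d) δ β')
      ≈⟨ +-cong (sym (coeff-pair d (- d) β γ β')) (sym (coeff-pair d (- d) γ δ β')) ⟩
    coeff ((d , β) ∷ (- d , γ) ∷ []) β' + coeff ((d , γ) ∷ (- d , δ) ∷ []) β'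
      ≈⟨ +-cong (e₁ β') (e₂ β') ⟩
    coeff (combValue L₁) β' + coeff (combValue L₂) β'
      ≈⟨ sym (coeff-++ (combValue L₁) _ β') ⟩
    coeff (combValue L₁ ++ combValue L₂) β'
      ≈⟨ sym (combValue-++ L₁ L₂ β') ⟩
    coeff (combValue (L₁ ++ L₂)) β' ∎

  -- d·y^β - d·y^β' = d·y^δ · (yᵢ^q - yᵢ) where β' is β lowered by q - 1 at i
  ≡ModE-lowerByQ-1 : ∀ β i → q ℕ.≤ lookup β i → β ≡ModE updateAt β i (_∸ q-1)
  ≡ModE-lowerByQ-1 β i q≤b d = L , λ β' → begin
    coeff ((d , β) ∷ (- d , β′) ∷ []) β'
      ≈⟨ coeff-pair d (- d) β β′ β' ⟩
    coeffTerm d β β' + coeffTerm (- d) β′ β'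
      ≈⟨ +-cong (coeffTerm-cong β β' (sym (*-identityʳ d))) (coeffTerm-cong β′ β' -d≈d*-1) ⟩
    coeffTerm (d * 1#) β β' + coeffTerm (d * - 1#) β′ β'
      ≡⟨ ≡.cong₂ (λ u v → coeffTerm (d * 1#) u β' + coeffTerm (d * - 1#) v β')
                 (≡.sym (lowerByQ+qExp β i q≤b)) (≡.sym (lowerByQ+unitExp β i q≤b)) ⟩
    coeffTerm (d * 1#) (δ +ᵐ qExp i) β' + coeffTerm (d * - 1#) (δ +ᵐ unitExp i) β'
      ≈⟨ sym (coeff-pair (d * 1#) (d * - 1#) (δ +ᵐ qExp i) (δ +ᵐ unitExp i) β') ⟩
    coeff product β'
      ≡⟨ ≡.cong (λ z → coeff z β') (≡.sym (≡.trans (LP.++-identityʳ (product ++ [])) (LP.++-identityʳ product))) ⟩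
    coeff (combValue L) β' ∎
    where
    δ = updateAt β i (_∸ q)
    β′ = updateAt β i (_∸ q-1)
    product = (d * 1# , δ +ᵐ qExp i) ∷ (d * - 1# , δ +ᵐ unitExp i) ∷ []
    L : Combination Eq
    L = (((d , δ) ∷ []) , fieldEq i , fieldEq∈Eq i) ∷ []
    -d≈d*-1 : - d ≈ d * - 1#
    -d≈d*-1 = trans (-‿cong (sym (*-identityʳ d))) (-‿distribʳ-* d 1#)

  -- by induction on the total degree: lower exponents ≥ q until all are standard
  ≡ModE-reduceExp : ∀ n β → totalDegree β ℕ.< n → β ≡ModE Vec.map reduceExp β
  ≡ModE-reduceExp (suc n) β lt with FinP.any? (λ i → q ℕ.≤? lookup β i)
  ... | yes (i , q≤b) = ≡ModE-trans {β} {updateAt β i (_∸ q-1)} {Vec.map reduceExp β} (≡ModE-lowerByQ-1 β i q≤b)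
          (≡.subst (updateAt β i (_∸ q-1) ≡ModE_) (reduceExp-lowerByQ-1 β i q≤b)
            (≡ModE-reduceExp n (updateAt β i (_∸ q-1)) (NP.≤-trans (lowerByQ-1-decreases β i q≤b) (NP.≤-pred lt))))
  ... | no none = ≡.subst (β ≡ModE_) (≡.sym (reduceExp-Standard β (¬q≤⇒Standard β (λ i q≤b → none (i , q≤b)))))
                    (≡ModE-refl β)

  ≡ModE-reduceMon : ∀ β → β ≡ModE toExp (reduceMon β)
  ≡ModE-reduceMon β = ≡.subst (β ≡ModE_) (≡.sym (toExp-reduceMon β))
                        (≡ModE-reduceExp (suc (totalDegree β)) β (NP.n<1+n _))

  open Truncate m using (truncate; truncCoeff; truncCoeff-low; truncate-vanishes)

  ≐truncate+combination : ∀ f → ∃[ L ] (f ≐ (truncate f ++ combValue {Eq} L))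
  ≐truncate+combination [] = [] , λ β → refl
  ≐truncate+combination ((d , β) ∷ f) with ≐truncate+combination f | ≡ModE-reduceMon β d
  ... | L , f≐ | Lβ , β≐ = Lβ ++ L , termwise
    where
    β′ = toExp (reduceMon β)
    termwise : ∀ γ → coeff ((d , β) ∷ f) γ ≈ coeff (truncate ((d , β) ∷ f) ++ combValue (Lβ ++ L)) γ
    termwise γ = begin
      coeff ((d , β) ∷ f) γ ≈⟨ coeff-cons d β f γ ⟩
      X + coeff f γ ≈⟨ +-congˡ (trans (f≐ γ) (coeff-++ (truncate f) _ γ)) ⟩
      X + (T + C) ≈⟨ +-congˡ (sym (+-identityˡ _)) ⟩
      X + (0# + (T + C)) ≈⟨ +-congˡ (+-congʳ (sym (trans (+-comm _ _) (coeffTerm-cancel d β′ γ)))) ⟩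
      X + ((Y + Y') + (T + C)) ≈⟨ +-regroup₅ X Y Y' T C ⟩
      (Y + T) + ((X + Y') + C)
        ≈⟨ +-cong (+-congʳ (coeffTerm-cong β′ γ (reflexive (≡.sym (truncCoeff-low β d (supp-≤ β))))))
                  (+-congʳ (trans (sym (coeff-pair d (- d) β β′ γ)) (β≐ γ))) ⟩
      (coeffTerm (truncCoeff β d) β′ γ + T) + (coeff (combValue Lβ) γ + C)
        ≈⟨ +-cong (sym (coeff-cons _ β′ (truncate f) γ)) (sym (coeff-++ (combValue Lβ) _ γ)) ⟩
      coeff (truncate ((d , β) ∷ f)) γ + coeff (combValue Lβ ++ combValue L) γ
        ≈⟨ +-congˡ (sym (combValue-++ Lβ L γ)) ⟩
      coeff (truncate ((d , β) ∷ f)) γ + coeff (combValue (Lβ ++ L)) γ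
        ≈⟨ sym (coeff-++ (truncate ((d , β) ∷ f)) _ γ) ⟩
      coeff (truncate ((d , β) ∷ f) ++ combValue (Lβ ++ L)) γ ∎
      where
      X = coeffTerm d β γ
      Y = coeffTerm d β′ γ
      Y' = coeffTerm (- d) β′ γ
      T = coeff (truncate f) γ
      C = coeff (combValue L) γ

  vanishing⇒combination : ∀ f → (∀ x → eval f x ≈ 0#) → ∃[ L ] (f ≐ combValue {Eq} L)
  vanishing⇒combination f vanish with ≐truncate+combination f
  ... | L , f≐ = L , λ β → trans (f≐ β) (trans (coeff-++ (truncate f) _ β)
                             (trans (+-congʳ (truncate-vanishes f (λ x _ → vanish x) β)) (+-identityˡ _)))


-- The elementary symmetric polynomials σ_s = ∑_{|b| = s} y^b (b ranging over
-- 0/1-vectors).  σ_s vanishes at every point of weight < s (each of its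
-- monomials involves s variables), while σ_{w(c)}(c) is the product of the
-- nonzero coordinates of c, hence nonzero.
module ElementarySymmetric {q : ℕ} (F : FiniteField q) (m : ℕ) where
  open FieldEquationIdeal F m public

  ΣList : ∀ {A : Set} → List A → (A → Carrier) → Carrier
  ΣList [] g = 0#
  ΣList (a ∷ L) g = g a + ΣList L g

  ΣList-++ : ∀ {A : Set} (L₁ L₂ : List A) g → ΣList (L₁ ++ L₂) g ≈ ΣList L₁ g + ΣList L₂ g
  ΣList-++ [] L₂ g = sym (+-identityˡ _)
  ΣList-++ (a ∷ L₁) L₂ g = trans (+-congˡ (ΣList-++ L₁ L₂ g)) (sym (+-assoc _ _ _))

  ΣList-concatMap : ∀ {A B : Set} (f : A → List B) (L : List A) g →
                    ΣList (concatMap f L) g ≈ ΣList L (λ a → ΣList (f a) g)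
  ΣList-concatMap f [] g = refl
  ΣList-concatMap f (a ∷ L) g = trans (ΣList-++ (f a) _ g) (+-congˡ (ΣList-concatMap f L g))

  ΣList-cong : ∀ {A : Set} (L : List A) {g h} → (∀ a → g a ≈ h a) → ΣList L g ≈ ΣList L h
  ΣList-cong [] e = refl
  ΣList-cong (a ∷ L) e = +-cong (e a) (ΣList-cong L e)

  ΣList-≈0 : ∀ {A : Set} (L : List A) {g} → (∀ a → g a ≈ 0#) → ΣList L g ≈ 0#
  ΣList-≈0 [] e = refl
  ΣList-≈0 (a ∷ L) e = trans (+-cong (e a) (ΣList-≈0 L e)) (+-identityˡ 0#)

  ΣList-*ˡ : ∀ {A : Set} (L : List A) c g → ΣList L (λ a → c * g a) ≈ c * ΣList L g
  ΣList-*ˡ [] c g = sym (zeroʳ c)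
  ΣList-*ˡ (a ∷ L) c g = trans (+-congˡ (ΣList-*ˡ L c g)) (sym (distribˡ c _ _))

  ones : ∀ {k} → Vec Bool k → ℕ
  ones b = count (λ y → y B.≟ true) b

  boolExp : ∀ {k} → Vec Bool k → Mon k
  boolExp = Vec.map boolToℕ

  supp-boolExp : ∀ {k} (b : Vec Bool k) → supp (boolExp b) ≡ ones b
  supp-boolExp [] = ≡.refl
  supp-boolExp (true ∷ b) = ≡.cong suc (supp-boolExp b)
  supp-boolExp (false ∷ b) = supp-boolExp b

  ifCount : ℕ → ℕ → Carrier → Carrier
  ifCount n s c with n ℕ.≟ s
  ... | yes _ = c
  ... | no _ = 0#

  ifCount-hit : ∀ n c → ifCount n n c ≡ c
  ifCount-hit n c with n ℕ.≟ n
  ... | yes _ = ≡.refl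
  ... | no n≢n = ⊥-elim (n≢n ≡.refl)

  ifCount-miss : ∀ n s c → n ≢ s → ifCount n s c ≡ 0#
  ifCount-miss n s c n≢s with n ℕ.≟ s
  ... | yes n≡s = ⊥-elim (n≢s n≡s)
  ... | no _ = ≡.refl

  ifCount-≈0 : ∀ n s {c} → c ≈ 0# → ifCount n s c ≈ 0#
  ifCount-≈0 n s c≈0 with n ℕ.≟ s
  ... | yes _ = c≈0
  ... | no _ = refl

  ifCount-cong : ∀ n s {c d} → c ≈ d → ifCount n s c ≈ ifCount n s d
  ifCount-cong n s c≈d with n ℕ.≟ s
  ... | yes _ = c≈d
  ... | no _ = refl

  σValue : ∀ k → ℕ → Vec Carrier k → Carrier
  σValue k s x = ΣList (allBools k) (λ b → ifCount (ones b) s (monValue x (boolExp b)))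

  eval-σ : ∀ s x → eval (σ s) x ≈ σValue m s x
  eval-σ s x = go (allBools m)
    where
    go : ∀ L → eval (List.map (λ α → (1# , α)) (List.map boolExp (filter (λ b → ones b ℕ.≟ s) L))) x
              ≈ ΣList L (λ b → ifCount (ones b) s (monValue x (boolExp b)))
    go [] = refl
    go (b ∷ L) = by-cases (ones b ℕ.≟ s)
      where
      by-cases : Dec (ones b ≡ s) →
        eval (List.map (λ α → (1# , α)) (List.map boolExp (filter (λ b → ones b ℕ.≟ s) (b ∷ L)))) x
          ≈ ΣList (b ∷ L) (λ b → ifCount (ones b) s (monValue x (boolExp b)))
      by-cases (yes p) rewrite LP.filter-accept (λ b → ones b ℕ.≟ s) {b} {L} p | p
                             | ifCount-hit s (monValue x (boolExp b)) =
        +-cong (trans (*-identityˡ _) (evalMon≈monValue x (boolExp b))) (go L)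
      by-cases (no np) rewrite LP.filter-reject (λ b → ones b ℕ.≟ s) {b} {L} np
                             | ifCount-miss (ones b) s (monValue x (boolExp b)) np =
        trans (go L) (sym (+-identityˡ _))

  σValue-vanishes : ∀ k s (x : Vec Carrier k) → wt x ℕ.< s → σValue k s x ≈ 0#
  σValue-vanishes k s x lt = ΣList-≈0 (allBools k) term≈0
    where
    term≈0 : ∀ b → ifCount (ones b) s (monValue x (boolExp b)) ≈ 0#
    term≈0 b with ones b ℕ.≟ s
    ... | yes e = monValue≈0-if-wt<supp x (boolExp b) (≡.subst (wt x ℕ.<_) (≡.sym (≡.trans (supp-boolExp b) e)) lt)
    ... | no _ = refl

  σValue-∷ : ∀ k s a (x : Vec Carrier k) →
    σValue (suc k) s (a ∷ x) ≈ ΣList (allBools k) (λ v → ifCount (suc (ones v)) s (a * 1# * monValue x (boolExp v))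
                                                        + ifCount (ones v) s (1# * monValue x (boolExp v)))
  σValue-∷ k s a x = trans (ΣList-concatMap _ (allBools k) _) (ΣList-cong (allBools k) (λ v → +-congˡ (+-identityʳ _)))

  σValue-∷-zero : ∀ k s {a} (x : Vec Carrier k) → a ≈ 0# → σValue (suc k) s (a ∷ x) ≈ σValue k s x
  σValue-∷-zero k s {a} x a≈0 = trans (σValue-∷ k s a x) (ΣList-cong (allBools k) (λ v →
    trans (+-cong (ifCount-≈0 (suc (ones v)) s (trans (*-congʳ (trans (*-congʳ a≈0) (zeroˡ _))) (zeroˡ _)))
                  (ifCount-cong (ones v) s (*-identityˡ (monValue x (boolExp v)))))
          (+-identityˡ _)))

  -- at s = w(x) + 1, the second sum vanishes by the pigeonhole lemma
  σValue-∷-nonzero : ∀ k a (x : Vec Carrier k) → σValue (suc k) (suc (wt x)) (a ∷ x) ≈ a * σValue k (wt x) x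
  σValue-∷-nonzero k a x = trans (σValue-∷ k (suc (wt x)) a x)
    (trans (ΣList-cong (allBools k) (λ v → trans (+-cong (first v) (second v)) (+-identityʳ _)))
           (ΣList-*ˡ (allBools k) a _))
    where
    first : ∀ v → ifCount (suc (ones v)) (suc (wt x)) (a * 1# * monValue x (boolExp v))
                  ≈ a * ifCount (ones v) (wt x) (monValue x (boolExp v))
    first v with ones v ℕ.≟ wt x
    ... | yes e = trans (reflexive (≡.subst (λ n → ifCount (suc n) (suc (wt x)) (a * 1# * monValue x (boolExp v))
                                                     ≡ a * 1# * monValue x (boolExp v))
                                      (≡.sym e) (ifCount-hit (suc (wt x)) _)))
                        (*-congʳ (*-identityʳ a))
    ... | no ne = trans (reflexive (ifCount-miss (suc (ones v)) (suc (wt x)) _ (λ p → ne (NP.suc-injective p))))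
                        (sym (zeroʳ a))
    second : ∀ v → ifCount (ones v) (suc (wt x)) (1# * monValue x (boolExp v)) ≈ 0#
    second v with ones v ℕ.≟ suc (wt x)
    ... | yes e = trans (*-identityˡ _) (monValue≈0-if-wt<supp x (boolExp v)
                    (≡.subst (wt x ℕ.<_) (≡.sym (≡.trans (supp-boolExp v) e)) (NP.n<1+n _)))
    ... | no _ = refl

  σValue-at-weight≉0 : ∀ k (x : Vec Carrier k) → ¬ σValue k (wt x) x ≈ 0#
  σValue-at-weight≉0 zero [] 1+0≈0 = 0≉1 (sym (trans (sym (+-identityʳ 1#)) 1+0≈0))
  σValue-at-weight≉0 (suc k) (a ∷ x) = by-cases (a ≟ 0#)
    where
    by-cases : Dec (a ≈ 0#) → ¬ σValue (suc k) (wt (a ∷ x)) (a ∷ x) ≈ 0#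
    by-cases (yes a≈0) σ≈0 = σValue-at-weight≉0 k x (trans (sym (σValue-∷-zero k (wt x) x a≈0))
      (≡.subst (λ s → σValue (suc k) s (a ∷ x) ≈ 0#) (wt-∷-zero x a≈0) σ≈0))
    by-cases (no a≉0) σ≈0 = *-preserves-≉0 a≉0 (σValue-at-weight≉0 k x) (trans (sym (σValue-∷-nonzero k a x))
      (≡.subst (λ s → σValue (suc k) s (a ∷ x) ≈ 0#) (wt-∷-nonzero x a≉0) σ≈0))

  σ-vanishes : ∀ s x → wt x ℕ.< s → eval (σ s) x ≈ 0#
  σ-vanishes s x lt = trans (eval-σ s x) (σValue-vanishes m s x lt)

  σ-at-weight≉0 : ∀ x → ¬ eval (σ (wt x)) x ≈ 0#
  σ-at-weight≉0 x σ≈0 = σValue-at-weight≉0 m x (trans (sym (eval-σ (wt x) x)) σ≈0)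

  σ∈sigmasFrom : ∀ t s → t ℕ.< s → s ℕ.≤ m → σ s ∈ sigmasFrom t
  σ∈sigmasFrom t s t<s s≤m = ≡.subst (λ z → σ z ∈ sigmasFrom t) (NP.m+[n∸m]≡n t<s)
                               (∈-map⁺ (λ k → σ (suc t ℕ.+ k)) (∈-upTo⁺ index<))
    where
    index< : s ∸ suc t ℕ.< m ∸ t
    index< = ≡.subst (ℕ._≤ m ∸ t) (NP.+-∸-assoc 1 t<s) (NP.∸-monoˡ-≤ t s≤m)


-- Indicator polynomials.  For c ∈ F^m, δ_c = ∏ᵢ (1 - (yᵢ - cᵢ)^(q-1)) takes
-- the value 1 at c and 0 at every other point (by Fermat, a^(q-1) = 1 for a ≉ 0).
module IndicatorPolynomials {q : ℕ} (F : FiniteField q) (m : ℕ) where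
  open ElementarySymmetric F m public

  monValue-0ᵐ : ∀ {k} (x : Vec Carrier k) → monValue x 0ᵐ ≈ 1#
  monValue-0ᵐ [] = refl
  monValue-0ᵐ (a ∷ x) = trans (*-identityˡ _) (monValue-0ᵐ x)

  monValue-singleExp : ∀ {k} (x : Vec Carrier k) i n → monValue x (updateAt 0ᵐ i (λ _ → n)) ≈ pow (lookup x i) n
  monValue-singleExp (a ∷ x) zero n = trans (*-congˡ (monValue-0ᵐ x)) (*-identityʳ _)
  monValue-singleExp (a ∷ x) (suc i) n = trans (*-identityˡ _) (monValue-singleExp x i n)

  eval-respects-≈v : ∀ f {x y} → x ≈v y → eval f x ≈ eval f y
  eval-respects-≈v [] x≈y = refl
  eval-respects-≈v ((d , β) ∷ f) {x} {y} x≈y =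
    +-cong (*-congˡ (trans (evalMon≈monValue x β) (trans (monValue-cong β x≈y) (sym (evalMon≈monValue y β)))))
           (eval-respects-≈v f x≈y)

  constPoly : Carrier → Poly
  constPoly a = (a , 0ᵐ) ∷ []

  eval-constPoly : ∀ a x → eval (constPoly a) x ≈ a
  eval-constPoly a x = trans (eval-cons a 0ᵐ [] x)
                         (trans (+-identityʳ _) (trans (*-congˡ (monValue-0ᵐ x)) (*-identityʳ a)))

  eval-var : ∀ i x → eval (var i) x ≈ lookup x i
  eval-var i x = trans (eval-cons 1# _ [] x)
                   (trans (+-identityʳ _) (trans (*-identityˡ _) (trans (monValue-singleExp x i 1) (*-identityʳ _))))

  negPoly : Poly → Poly
  negPoly = List.map (λ term → (- proj₁ term , proj₂ term))

  eval-negPoly : ∀ f x → eval (negPoly f) x ≈ - eval f x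
  eval-negPoly [] x = sym -0#≈0#
  eval-negPoly ((d , β) ∷ f) x = begin
    - d * evalMon x β + eval (negPoly f) x ≈⟨ +-cong (sym (-‿distribˡ-* d _)) (eval-negPoly f x) ⟩
    - (d * evalMon x β) + - eval f x       ≈⟨ -‿+-comm _ _ ⟩
    - (d * evalMon x β + eval f x) ∎

  coeff-negPoly : ∀ f β → coeff (negPoly f) β ≈ - coeff f β
  coeff-negPoly [] β = sym -0#≈0#
  coeff-negPoly ((d , α) ∷ f) β with VecP.≡-dec ℕ._≟_ α β
  ... | yes _ = trans (+-congˡ (coeff-negPoly f β)) (-‿+-comm _ _)
  ... | no _ = coeff-negPoly f β

  scalePoly : Carrier → Poly → Poly
  scalePoly a = List.map (λ term → (a * proj₁ term , proj₂ term))

  eval-scalePoly : ∀ a f x → eval (scalePoly a f) x ≈ a * eval f x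
  eval-scalePoly a [] x = sym (zeroʳ a)
  eval-scalePoly a ((d , β) ∷ f) x = trans (+-cong (*-assoc a d _) (eval-scalePoly a f x)) (sym (distribˡ a _ _))

  polyPow : Poly → ℕ → Poly
  polyPow p zero = constPoly 1#
  polyPow p (suc n) = p *ₚ polyPow p n

  eval-polyPow : ∀ p n x → eval (polyPow p n) x ≈ pow (eval p x) n
  eval-polyPow p zero x = eval-constPoly 1# x
  eval-polyPow p (suc n) x = trans (eval-* p (polyPow p n) x) (*-congˡ (eval-polyPow p n x))

  pow-[q-1]≈1 : ∀ y → ¬ y ≈ 0# → pow y q-1 ≈ 1#
  pow-[q-1]≈1 y y≉0 = *-cancelˡ-≉0 y≉0 (trans (fermat-suc y) (sym (*-identityʳ y)))

  coordIndicator : Carrier → Fin m → Poly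
  coordIndicator a i = constPoly 1# ++ negPoly (polyPow (var i ++ constPoly (- a)) q-1)

  eval-coordIndicator : ∀ a i x → eval (coordIndicator a i) x ≈ 1# - pow (lookup x i - a) q-1
  eval-coordIndicator a i x = begin
    eval (constPoly 1# ++ negPoly P) x         ≈⟨ eval-++ (constPoly 1#) (negPoly P) x ⟩
    eval (constPoly 1#) x + eval (negPoly P) x ≈⟨ +-cong (eval-constPoly 1# x) (eval-negPoly P x) ⟩
    1# - eval P x                              ≈⟨ +-congˡ (-‿cong (eval-polyPow (var i ++ constPoly (- a)) q-1 x)) ⟩
    1# - pow (eval (var i ++ constPoly (- a)) x) q-1
      ≈⟨ +-congˡ (-‿cong (pow-cong q-1 (trans (eval-++ (var i) (constPoly (- a)) x)
                                              (+-cong (eval-var i x) (eval-constPoly (- a) x))))) ⟩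
    1# - pow (lookup x i - a) q-1 ∎
    where
    P = polyPow (var i ++ constPoly (- a)) q-1

  coordIndicator-hit : ∀ a i x → lookup x i ≈ a → eval (coordIndicator a i) x ≈ 1#
  coordIndicator-hit a i x xᵢ≈a = trans (eval-coordIndicator a i x)
    (trans (+-congˡ (-‿cong (trans (pow-cong q-1 (x≈y⇒x∙y⁻¹≈ε xᵢ≈a)) (pow-0# q-2))))
           (trans (+-congˡ -0#≈0#) (+-identityʳ 1#)))

  coordIndicator-miss : ∀ a i x → ¬ lookup x i ≈ a → eval (coordIndicator a i) x ≈ 0#
  coordIndicator-miss a i x xᵢ≉a = trans (eval-coordIndicator a i x)
    (trans (+-congˡ (-‿cong (pow-[q-1]≈1 _ (≉⇒difference≉0 xᵢ≉a)))) (-‿inverseʳ 1#))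

  ΠList : List (Fin m) → (Fin m → Carrier) → Carrier
  ΠList [] g = 1#
  ΠList (i ∷ L) g = g i * ΠList L g

  ΠList-≈1 : ∀ L g → (∀ i → g i ≈ 1#) → ΠList L g ≈ 1#
  ΠList-≈1 [] g _ = refl
  ΠList-≈1 (i ∷ L) g g≈1 = trans (*-cong (g≈1 i) (ΠList-≈1 L g g≈1)) (*-identityˡ 1#)

  ΠList-≈0 : ∀ L g i → i ∈ L → g i ≈ 0# → ΠList L g ≈ 0#
  ΠList-≈0 (j ∷ L) g i (here ≡.refl) gᵢ≈0 = trans (*-congʳ gᵢ≈0) (zeroˡ _)
  ΠList-≈0 (j ∷ L) g i (there p) gᵢ≈0 = trans (*-congˡ (ΠList-≈0 L g i p gᵢ≈0)) (zeroʳ _)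

  indicatorProduct : Vec Carrier m → List (Fin m) → Poly
  indicatorProduct c = List.foldr (λ i acc → coordIndicator (lookup c i) i *ₚ acc) (constPoly 1#)

  eval-indicatorProduct : ∀ c x L → eval (indicatorProduct c L) x ≈ ΠList L (λ i → eval (coordIndicator (lookup c i) i) x)
  eval-indicatorProduct c x [] = eval-constPoly 1# x
  eval-indicatorProduct c x (i ∷ L) = trans (eval-* (coordIndicator (lookup c i) i) (indicatorProduct c L) x)
                                        (*-congˡ (eval-indicatorProduct c x L))

  pointIndicator : Vec Carrier m → Poly
  pointIndicator c = indicatorProduct c (List.allFin m)

  pointIndicator-hit : ∀ c x → x ≈v c → eval (pointIndicator c) x ≈ 1#
  pointIndicator-hit c x x≈c = trans (eval-indicatorProduct c x (List.allFin m))
    (ΠList-≈1 (List.allFin m) _ (λ i → coordIndicator-hit (lookup c i) i x (Pointwise.lookup x≈c i)))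

  pointIndicator-miss : ∀ c x i → ¬ lookup x i ≈ lookup c i → eval (pointIndicator c) x ≈ 0#
  pointIndicator-miss c x i xᵢ≉cᵢ = trans (eval-indicatorProduct c x (List.allFin m))
    (ΠList-≈0 (List.allFin m) _ i (∈-allFin i) (coordIndicator-miss (lookup c i) i x xᵢ≉cᵢ))


-- First part of the theorem: I(Q_t) = ⟨σ_{t+1}, …, σ_m⟩ + ⟨E_q[Y]⟩.
-- (⊇) every generator vanishes on Q_t.  (⊆) for f ∈ I(Q_t) put
--   P = ∑_{c : w(c) > t} (f(c) / σ_{w(c)}(c)) · δ_c · σ_{w(c)} ∈ ⟨σ_{t+1}, …, σ_m⟩;
-- P agrees with f on all of F^m (at points of weight ≤ t both vanish), so
-- f - P vanishes on F^m and lies in ⟨E_q[Y]⟩.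
module VanishingIdealGenerators {q : ℕ} (F : FiniteField q) (m : ℕ) where
  open IndicatorPolynomials F m public

  -- the points of F^m are indexed by Vec (Fin q) m via the enumeration of F
  allBoxPoints : ∀ k → List (Vec (Fin q) k)
  allBoxPoints zero = [] ∷ []
  allBoxPoints (suc k) = concatMap (λ i → List.map (i ∷_) (allBoxPoints k)) (List.allFin q)

  ΣList-map : ∀ {A B : Set} (h : A → B) (L : List A) g → ΣList (List.map h L) g ≈ ΣList L (λ a → g (h a))
  ΣList-map h [] g = refl
  ΣList-map h (a ∷ L) g = +-congˡ (ΣList-map h L g)

  ΣList-tabulate : ∀ {A : Set} n (f : Fin n → A) g → ΣList (List.tabulate f) g ≈ ΣFin n (λ i → g (f i))
  ΣList-tabulate zero f g = refl
  ΣList-tabulate (suc n) f g = +-congˡ (ΣList-tabulate n (λ i → f (suc i)) g)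

  ΣList-allBoxPoints : ∀ k G → ΣList (allBoxPoints k) G ≈ ΣBox q k G
  ΣList-allBoxPoints zero G = +-identityʳ _
  ΣList-allBoxPoints (suc k) G = begin
    ΣList (concatMap (λ i → List.map (i ∷_) (allBoxPoints k)) (List.allFin q)) G
      ≈⟨ ΣList-concatMap _ (List.allFin q) G ⟩
    ΣList (List.allFin q) (λ i → ΣList (List.map (i ∷_) (allBoxPoints k)) G)
      ≈⟨ ΣList-tabulate q (λ i → i) _ ⟩
    ΣFin q (λ i → ΣList (List.map (i ∷_) (allBoxPoints k)) G)
      ≈⟨ ΣFin-cong q (λ i → trans (ΣList-map (i ∷_) (allBoxPoints k) G) (ΣList-allBoxPoints k _)) ⟩
    ΣBox q (suc k) G ∎

  eval-combValue : ∀ {S} (L : Combination S) x →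
                   eval (combValue L) x ≈ ΣList L (λ e → eval (proj₁ e) x * eval (proj₁ (proj₂ e)) x)
  eval-combValue [] x = refl
  eval-combValue ((u , g , p) ∷ L) x =
    trans (eval-++ (u *ₚ g) (combValue L) x) (+-cong (eval-* u g x) (eval-combValue L x))

  ≢⇒differingCoordinate : ∀ {k} (u v : Vec (Fin q) k) → u ≢ v → ∃[ i ] (lookup u i ≢ lookup v i)
  ≢⇒differingCoordinate [] [] u≢v = ⊥-elim (u≢v ≡.refl)
  ≢⇒differingCoordinate (a ∷ u) (b ∷ v) u≢v with a FinP.≟ b
  ... | no a≢b = zero , a≢b
  ... | yes ≡.refl with ≢⇒differingCoordinate u v (λ e → u≢v (≡.cong (a ∷_) e))
  ...   | i , differs = suc i , differs

  boxPoint : ∀ {k} → Vec (Fin q) k → Vec Carrier k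
  boxPoint = Vec.map enum

  boxIndex : ∀ {k} → Vec Carrier k → Vec (Fin q) k
  boxIndex = Vec.map (λ a → proj₁ (enum-surj a))

  boxPoint-boxIndex : ∀ {k} (x : Vec Carrier k) → boxPoint (boxIndex x) ≈v x
  boxPoint-boxIndex [] = []
  boxPoint-boxIndex (a ∷ x) = proj₂ (enum-surj a) ∷ boxPoint-boxIndex x

  boxPoint-differs : ∀ {k} (x : Vec Carrier k) γ i → lookup γ i ≢ lookup (boxIndex x) i →
                     ¬ lookup x i ≈ lookup (boxPoint γ) i
  boxPoint-differs (a ∷ x) (g ∷ γ) zero ne e = ne (enum-inj _ _ (trans (sym e) (sym (proj₂ (enum-surj a)))))
  boxPoint-differs (a ∷ x) (g ∷ γ) (suc i) ne e = boxPoint-differs x γ i ne e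

  module Interpolation (t : ℕ) (f : Poly) (vanish : InVanishingIdealQ t f) where
    σ-at : Vec (Fin q) m → Carrier
    σ-at γ = eval (σ (wt (boxPoint γ))) (boxPoint γ)

    σ-at⁻¹ : Vec (Fin q) m → Carrier
    σ-at⁻¹ γ = proj₁ (inverse (σ-at γ) (σ-at-weight≉0 (boxPoint γ)))

    weight : Vec (Fin q) m → Carrier
    weight γ = eval f (boxPoint γ) * σ-at⁻¹ γ

    summand : ∀ γ → Dec (t ℕ.< wt (boxPoint γ)) → Combination (sigmasFrom t)
    summand γ (yes t<w) = ( scalePoly (weight γ) (pointIndicator (boxPoint γ)) , σ (wt (boxPoint γ))
                          , σ∈sigmasFrom t (wt (boxPoint γ)) t<w (wt-≤ (boxPoint γ))) ∷ []
    summand γ (no _) = []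

    entry : Vec (Fin q) m → Combination (sigmasFrom t)
    entry γ = summand γ (t ℕ.<? wt (boxPoint γ))

    combinationP : Combination (sigmasFrom t)
    combinationP = concatMap entry (allBoxPoints m)

    P : Poly
    P = combValue combinationP

    valueAt : Vec Carrier m → (Σ Poly λ u → Σ Poly λ g → g ∈ sigmasFrom t) → Carrier
    valueAt x e = eval (proj₁ e) x * eval (proj₁ (proj₂ e)) x

    contribution : Vec Carrier m → Vec (Fin q) m → Carrier
    contribution x γ = ΣList (entry γ) (valueAt x)

    contribution-elsewhere : ∀ x γ → eval (pointIndicator (boxPoint γ)) x ≈ 0# → contribution x γ ≈ 0#
    contribution-elsewhere x γ δ≈0 = by-cases (t ℕ.<? wt (boxPoint γ))
      where
      by-cases : ∀ d → ΣList (summand γ d) (valueAt x) ≈ 0#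
      by-cases (yes _) = trans (+-identityʳ _) (trans (*-congʳ (trans (eval-scalePoly (weight γ) (pointIndicator (boxPoint γ)) x)
                           (trans (*-congˡ δ≈0) (zeroʳ _)))) (zeroˡ _))
      by-cases (no _) = refl

    contribution-at : ∀ x → contribution x (boxIndex x) ≈ eval f x
    contribution-at x = by-cases (t ℕ.<? wt c)
      where
      γ = boxIndex x
      c = boxPoint γ
      c≈x : c ≈v x
      c≈x = boxPoint-boxIndex x
      x≈c = Pointwise.sym sym c≈x
      by-cases : ∀ d → ΣList (summand γ d) (valueAt x) ≈ eval f x
      by-cases (yes _) = begin
        eval (scalePoly (weight γ) (pointIndicator c)) x * eval (σ (wt c)) x + 0# ≈⟨ +-identityʳ _ ⟩
        eval (scalePoly (weight γ) (pointIndicator c)) x * eval (σ (wt c)) x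
          ≈⟨ *-cong (trans (eval-scalePoly (weight γ) (pointIndicator c) x)
                           (trans (*-congˡ (pointIndicator-hit c x x≈c)) (*-identityʳ _)))
                    (eval-respects-≈v (σ (wt c)) x≈c) ⟩
        (eval f c * σ-at⁻¹ γ) * σ-at γ ≈⟨ *-assoc _ _ _ ⟩
        eval f c * (σ-at⁻¹ γ * σ-at γ) ≈⟨ *-congˡ (trans (*-comm _ _) (proj₂ (inverse (σ-at γ) (σ-at-weight≉0 c)))) ⟩
        eval f c * 1#                  ≈⟨ *-identityʳ _ ⟩
        eval f c                       ≈⟨ eval-respects-≈v f c≈x ⟩
        eval f x ∎
      by-cases (no ¬t<w) = sym (vanish x (≡.subst (ℕ._≤ t) (wt-cong c≈x) (NP.≮⇒≥ ¬t<w)))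

    eval-P : ∀ x → eval P x ≈ eval f x
    eval-P x = begin
      eval (combValue combinationP) x    ≈⟨ eval-combValue combinationP x ⟩
      ΣList combinationP (valueAt x)     ≈⟨ ΣList-concatMap entry (allBoxPoints m) (valueAt x) ⟩
      ΣList (allBoxPoints m) (contribution x) ≈⟨ ΣList-allBoxPoints m (contribution x) ⟩
      ΣBox q m (contribution x)          ≈⟨ ΣBox-single q m (boxIndex x) (contribution x) elsewhere ⟩
      contribution x (boxIndex x)        ≈⟨ contribution-at x ⟩
      eval f x ∎
      where
      elsewhere : ∀ γ → γ ≢ boxIndex x → contribution x γ ≈ 0#
      elsewhere γ γ≢ with ≢⇒differingCoordinate γ (boxIndex x) γ≢
      ... | i , differs = contribution-elsewhere x γ
                            (pointIndicator-miss (boxPoint γ) x i (boxPoint-differs x γ i differs))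

    f-P : Poly
    f-P = f ++ negPoly P

    f-P-vanishes : ∀ x → eval f-P x ≈ 0#
    f-P-vanishes x = trans (eval-++ f (negPoly P) x)
                       (trans (+-congˡ (trans (eval-negPoly P x) (-‿cong (eval-P x)))) (-‿inverseʳ _))

    f≐[f-P]+P : ∀ β → coeff f β ≈ coeff f-P β + coeff P β
    f≐[f-P]+P β = begin
      coeff f β                                     ≈⟨ sym (+-identityʳ _) ⟩
      coeff f β + 0#                                ≈⟨ +-congˡ (sym (-‿inverseˡ _)) ⟩
      coeff f β + (- coeff P β + coeff P β)         ≈⟨ sym (+-assoc _ _ _) ⟩
      (coeff f β + - coeff P β) + coeff P β         ≈⟨ +-congʳ (+-congˡ (sym (coeff-negPoly P β))) ⟩
      (coeff f β + coeff (negPoly P) β) + coeff P β ≈⟨ +-congʳ (sym (coeff-++ f (negPoly P) β)) ⟩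
      coeff f-P β + coeff P β ∎

    ∈ideal : f ∈⟨ sigmasFrom t ++ Eq ⟩
    ∈ideal with vanishing⇒combination f-P f-P-vanishes
    ... | LE , f-P≐ = combination⇒∈⟨⟩ f (LE′ ++ LP′) f≐
      where
      LE′ LP′ : Combination (sigmasFrom t ++ Eq)
      LE′ = combRelabel (∈-++⁺ʳ (sigmasFrom t)) LE
      LP′ = combRelabel ∈-++⁺ˡ combinationP
      f≐ : f ≐ combValue (LE′ ++ LP′)
      f≐ β = begin
        coeff f β                                   ≈⟨ f≐[f-P]+P β ⟩
        coeff f-P β + coeff P β                     ≈⟨ +-congʳ (f-P≐ β) ⟩
        coeff (combValue LE) β + coeff P β
          ≡⟨ ≡.cong₂ (λ a b → coeff a β + coeff b β) (≡.sym (combRelabel-value _ LE)) (≡.sym (combRelabel-value _ combinationP)) ⟩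
        coeff (combValue LE′) β + coeff (combValue LP′) β ≈⟨ sym (coeff-++ (combValue LE′) _ β) ⟩
        coeff (combValue LE′ ++ combValue LP′) β    ≈⟨ sym (combValue-++ LE′ LP′ β) ⟩
        coeff (combValue (LE′ ++ LP′)) β ∎

  linComb-vanishes : ∀ hs S x → (∀ g → g ∈ S → eval g x ≈ 0#) → eval (linComb hs S) x ≈ 0#
  linComb-vanishes [] S x _ = refl
  linComb-vanishes (h₀ ∷ hs) [] x _ = refl
  linComb-vanishes (h₀ ∷ hs) (s ∷ S) x S-vanishes = trans (eval-++ (h₀ *ₚ s) (linComb hs S) x)
    (trans (+-cong (trans (eval-* h₀ s x) (trans (*-congˡ (S-vanishes s (here ≡.refl))) (zeroʳ _)))
                   (linComb-vanishes hs S x (λ g p → S-vanishes g (there p))))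
           (+-identityˡ 0#))

  fieldEq-vanishes : ∀ i x → eval (fieldEq i) x ≈ 0#
  fieldEq-vanishes i x = begin
    1# * evalMon x (qExp i) + (- 1# * evalMon x (unitExp i) + 0#)
      ≈⟨ +-cong (trans (*-identityˡ _) (trans (evalMon≈monValue x (qExp i)) (monValue-singleExp x i q)))
                (trans (+-identityʳ _) (*-congˡ (trans (evalMon≈monValue x (unitExp i)) (monValue-singleExp x i 1)))) ⟩
    pow (lookup x i) q + - 1# * pow (lookup x i) 1
      ≈⟨ +-cong (fermat _) (trans (sym (-‿distribˡ-* 1# (pow (lookup x i) 1))) (-‿cong (trans (*-identityˡ _) (*-identityʳ _)))) ⟩
    lookup x i - lookup x i ≈⟨ -‿inverseʳ _ ⟩
    0# ∎

  generators-vanish-on-Q : ∀ t g → g ∈ sigmasFrom t ++ Eq → ∀ x → wt x ℕ.≤ t → eval g x ≈ 0#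
  generators-vanish-on-Q t g g∈ x wt≤t with ∈-++⁻ (sigmasFrom t) g∈
  ... | inj₁ g∈σ with ∈-map⁻ (λ k → σ (suc t ℕ.+ k)) g∈σ
  ...   | k , _ , ≡.refl = σ-vanishes (suc t ℕ.+ k) x (s≤s (NP.≤-trans wt≤t (NP.m≤m+n t k)))
  generators-vanish-on-Q t g g∈ x wt≤t | inj₂ g∈E with ∈-map⁻ _ g∈E
  ...   | i , _ , ≡.refl = fieldEq-vanishes i x

  ideal⊆vanishing : ∀ t f → f ∈⟨ sigmasFrom t ++ Eq ⟩ → InVanishingIdealQ t f
  ideal⊆vanishing t f (hs , f≐ , _) x wt≤t =
    trans (eval-respects-≐ f (linComb hs (sigmasFrom t ++ Eq)) f≐ x)
          (linComb-vanishes hs (sigmasFrom t ++ Eq) x (λ g g∈ → generators-vanish-on-Q t g g∈ x wt≤t))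

  vanishing⇔ideal : ∀ t f → InVanishingIdealQ t f ⇔ (f ∈⟨ sigmasFrom t ++ Eq ⟩)
  vanishing⇔ideal t f = mk⇔ (Interpolation.∈ideal t f) (ideal⊆vanishing t f)


-- Call g headed by α if coeff g α = 1 and every monomial of g divides
-- α; then α is the leading monomial of g in every admissible order.
module ReducedGroebnerCriterion {q : ℕ} (F : FiniteField q) (m : ℕ) (ord : TermOrder m) where
  open VanishingIdealGenerators F m public
  module O = TermOrderFacts ord
  open TermOrder ord using () renaming (_≤_ to _≼_)

  LM-unique : ∀ g α α' → IsLM ord g α → IsLM ord g α' → α ≡ α'
  LM-unique g α α' (α≉0 , α-max) (α'≉0 , α'-max) with α'-max α α≉0 | α-max α' α'≉0
  ... | inj₂ α≡α' | _ = α≡α'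
  ... | inj₁ α<α' | α'≼α = ⊥-elim (O.<⇒≱ α<α' α'≼α)

  Headed : Poly → Mon m → Set
  Headed g α = (coeff g α ≈ 1#) × (∀ β → ¬ coeff g β ≈ 0# → β ∣ᵐ α)

  Headed⇒LM : ∀ g α → Headed g α → IsLM ord g α
  Headed⇒LM g α (α≈1 , divides) = (λ α≈0 → 0≉1 (trans (sym α≈0) α≈1)) , (λ β β≉0 → O.∣⇒≤ β α (divides β β≉0))

  ∣-refl : ∀ {k} (α : Mon k) → α ∣ᵐ α
  ∣-refl α i = NP.≤-refl

  lookup-injective : ∀ {A : Set} (xs : List A) → Unique xs → ∀ i j → List.lookup xs i ≡ List.lookup xs j → i ≡ j
  lookup-injective (x ∷ xs) (x∉ ∷ u) zero zero e = ≡.refl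
  lookup-injective (x ∷ xs) (x∉ ∷ u) zero (suc j) e = ⊥-elim (All.lookup x∉ (∈-lookup {xs = xs} j) e)
  lookup-injective (x ∷ xs) (x∉ ∷ u) (suc i) zero e = ⊥-elim (All.lookup x∉ (∈-lookup {xs = xs} i) (≡.sym e))
  lookup-injective (x ∷ xs) (x∉ ∷ u) (suc i) (suc j) e = ≡.cong suc (lookup-injective xs u i j e)

  support⊆exponents : ∀ f β → ¬ coeff f β ≈ 0# → β ∈ List.map proj₂ f
  support⊆exponents [] β β≉0 = ⊥-elim (β≉0 refl)
  support⊆exponents ((d , α) ∷ f) β β≉0 with VecP.≡-dec ℕ._≟_ α β
  ... | yes ≡.refl = here ≡.refl
  ... | no _ = there (support⊆exponents f β β≉0)

  MaxInSupport : Poly → List (Mon m) → Set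
  MaxInSupport f L = (∀ β → β ∈ L → coeff f β ≈ 0#)
                   ⊎ (∃[ α ] (¬ coeff f α ≈ 0# × (∀ β → β ∈ L → ¬ coeff f β ≈ 0# → β ≼ α)))

  maxInSupport : ∀ f L → MaxInSupport f L
  maxInSupport f [] = inj₁ (λ β ())
  maxInSupport f (b ∷ L) with coeff f b ≟ 0# | maxInSupport f L
  ... | yes b≈0 | inj₁ none = inj₁ (λ { β (here ≡.refl) → b≈0 ; β (there p) → none β p })
  ... | yes b≈0 | inj₂ (α , α≉0 , max) =
    inj₂ (α , α≉0 , λ { β (here ≡.refl) b≉0 → ⊥-elim (b≉0 b≈0) ; β (there p) β≉0 → max β p β≉0 })
  ... | no b≉0 | inj₁ none =
    inj₂ (b , b≉0 , λ { β (here ≡.refl) _ → inj₂ ≡.refl ; β (there p) β≉0 → ⊥-elim (β≉0 (none β p)) })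
  ... | no b≉0 | inj₂ (α , α≉0 , max) with O.STO.compare b α
  ...   | tri< b<α _ _ = inj₂ (α , α≉0 , λ { β (here ≡.refl) _ → inj₁ b<α ; β (there p) β≉0 → max β p β≉0 })
  ...   | tri≈ _ b≡α _ = inj₂ (α , α≉0 , λ { β (here ≡.refl) _ → inj₂ b≡α ; β (there p) β≉0 → max β p β≉0 })
  ...   | tri> _ _ α<b = inj₂ (b , b≉0 , λ { β (here ≡.refl) _ → inj₂ ≡.refl
                                           ; β (there p) β≉0 → inj₁ (O.≤-trans-< (max β p β≉0) α<b) })

  LM-exists : ∀ f → Nonzero f → ∃[ α ] IsLM ord f α
  LM-exists f (β₀ , β₀≉0) with maxInSupport f (List.map proj₂ f)
  ... | inj₁ none = ⊥-elim (β₀≉0 (none β₀ (support⊆exponents f β₀ β₀≉0)))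
  ... | inj₂ (α , α≉0 , max) = α , α≉0 , λ β β≉0 → max β (support⊆exponents f β β≉0) β≉0

  reducedGB-criterion : ∀ (I : Poly → Set) (G : List Poly) →
    (∀ g → g ∈ G → I g) →
    (∀ g → g ∈ G → ∃[ α ] Headed g α) →
    Unique G →
    (∀ g h → g ∈ G → h ∈ G → ∀ α → Headed g α → ∀ β → ¬ coeff h β ≈ 0# → α ∣ᵐ β → g ≡ h) →
    (∀ f → I f → ∀ β → IsLM ord f β → ∃[ g ] (g ∈ G × ∃[ α ] (Headed g α × α ∣ᵐ β))) →
    IsReducedGB ord I G
  reducedGB-criterion I G G⊆I G-headed G-unique G-reduced G-divides-LM = record
    { G⊆I = λ i → G⊆I _ (gᵢ∈G i)
    ; lm = λ i → proj₁ (G-headed _ (gᵢ∈G i)) , Headed⇒LM (List.lookup G i) _ (proj₂ (G-headed _ (gᵢ∈G i)))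
    ; groebner = groebner
    ; monic = monic
    ; reduced = reduced
    ; distinct = distinct
    }
    where
    gᵢ∈G : ∀ i → List.lookup G i ∈ G
    gᵢ∈G i = ∈-lookup {xs = G} i

    head≡LM : ∀ i α → IsLM ord (List.lookup G i) α → ∃[ α₀ ] (Headed (List.lookup G i) α₀ × α₀ ≡ α)
    head≡LM i α lm with G-headed _ (gᵢ∈G i)
    ... | α₀ , headed = α₀ , headed , LM-unique (List.lookup G i) α₀ α (Headed⇒LM (List.lookup G i) _ headed) lm

    monic : ∀ i α → IsLM ord (List.lookup G i) α → coeff (List.lookup G i) α ≈ 1#
    monic i α lm with head≡LM i α lm
    ... | α₀ , headed , ≡.refl = proj₁ headed

    reduced : ∀ i j → i ≢ j → ∀ α → IsLM ord (List.lookup G i) α →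
              ∀ β → ¬ (coeff (List.lookup G j) β ≈ 0#) → ¬ (α ∣ᵐ β)
    reduced i j i≢j α lm β β≉0 α∣β with head≡LM i α lm
    ... | α₀ , headed , ≡.refl =
      i≢j (lookup-injective G G-unique i j (G-reduced _ _ (gᵢ∈G i) (gᵢ∈G j) α₀ headed β β≉0 α∣β))

    distinct : ∀ i j → List.lookup G i ≐ List.lookup G j → i ≡ j
    distinct i j gᵢ≐gⱼ with i FinP.≟ j
    ... | yes i≡j = i≡j
    ... | no i≢j with G-headed _ (gᵢ∈G i)
    ...   | α₀ , headed = ⊥-elim (reduced i j i≢j α₀ (Headed⇒LM (List.lookup G i) _ headed) α₀
                              (λ α₀≈0 → 0≉1 (sym (trans (sym (proj₁ headed)) (trans (gᵢ≐gⱼ α₀) α₀≈0))))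
                              (∣-refl α₀))

    groebner : ∀ f → I f → Nonzero f → ∃[ i ] ∃[ α ] ∃[ β ] (IsLM ord (List.lookup G i) α × IsLM ord f β × α ∣ᵐ β)
    groebner f f∈I f≉0 with LM-exists f f≉0
    ... | β , lm with G-divides-LM f f∈I β lm
    ...   | g , g∈G , α , headed , α∣β = Any.index g∈G , α , β ,
              ≡.subst (λ z → IsLM ord z α) (AnyP.lookup-index g∈G) (Headed⇒LM g α headed) , lm , α∣β


module GroebnerCandidates {q : ℕ} (F : FiniteField q) (m : ℕ) (ord : TermOrder m) where
  open ReducedGroebnerCriterion F m ord public

  singleExp : ∀ {k} → Fin k → ℕ → Mon k
  singleExp i n = updateAt 0ᵐ i (λ _ → n)

  singleExp-at : ∀ {k} (i : Fin k) n → lookup (singleExp i n) i ≡ n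
  singleExp-at zero n = ≡.refl
  singleExp-at (suc i) n = singleExp-at i n

  singleExp-elsewhere : ∀ {k} (i j : Fin k) n → i ≢ j → lookup (singleExp i n) j ≡ 0
  singleExp-elsewhere zero zero n ne = ⊥-elim (ne ≡.refl)
  singleExp-elsewhere zero (suc j) n ne = VecP.lookup-replicate j 0
  singleExp-elsewhere (suc i) zero n ne = ≡.refl
  singleExp-elsewhere (suc i) (suc j) n ne = singleExp-elsewhere i j n (λ e → ne (≡.cong suc e))

  2≤q : 2 ℕ.≤ q
  2≤q = ≡.subst (2 ℕ.≤_) (≡.sym q≡1+[q-1]) (s≤s (s≤s z≤n))

  singleExp-∣-injective : ∀ {k} (a c : Fin k) n → 1 ℕ.≤ n → singleExp a n ∣ᵐ singleExp c n → a ≡ c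
  singleExp-∣-injective a c n pos d with a FinP.≟ c
  ... | yes p = p
  ... | no ne = ⊥-elim (NP.<⇒≱ pos (≡.subst₂ ℕ._≤_ (singleExp-at a n) (singleExp-elsewhere c a n (λ e → ne (≡.sym e))) (d a)))

  singleExp-≤ : ∀ {k} (c j : Fin k) n → lookup (singleExp c n) j ℕ.≤ n
  singleExp-≤ c j n with c FinP.≟ j
  ... | yes ≡.refl = NP.≤-reflexive (singleExp-at c n)
  ... | no ne = ≡.subst (ℕ._≤ n) (≡.sym (singleExp-elsewhere c j n ne)) z≤n

  -- since q ≥ 2, yₐ^q divides neither a variable nor a squarefree monomial
  qExp∤unitExp : ∀ a c → ¬ (qExp a ∣ᵐ unitExp c)
  qExp∤unitExp a c d = NP.<⇒≱ (NP.<-≤-trans (s≤s (s≤s z≤n)) 2≤q) (NP.≤-trans (≡.subst (ℕ._≤ _) (singleExp-at a q) (d a)) (singleExp-≤ c a 1))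

  boolToℕ≤1 : ∀ x → boolToℕ x ℕ.≤ 1
  boolToℕ≤1 true = s≤s z≤n
  boolToℕ≤1 false = z≤n

  lookup-boolExp : ∀ {k} (b : Vec Bool k) j → lookup (boolExp b) j ≡ boolToℕ (lookup b j)
  lookup-boolExp b j = VecP.lookup-map j boolToℕ b

  qExp∤boolExp : ∀ a (b : Vec Bool m) → ¬ (qExp a ∣ᵐ boolExp b)
  qExp∤boolExp a b d = NP.<⇒≱ (NP.<-≤-trans (s≤s (s≤s z≤n)) 2≤q) (NP.≤-trans (≡.subst (ℕ._≤ _) (singleExp-at a q) (d a)) (≡.subst (ℕ._≤ 1) (≡.sym (lookup-boolExp b a)) (boolToℕ≤1 _)))

  boolExp∣0ᵐ⇒ones≡0 : ∀ {k} (b : Vec Bool k) → boolExp b ∣ᵐ 0ᵐ → ones b ≡ 0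
  boolExp∣0ᵐ⇒ones≡0 [] d = ≡.refl
  boolExp∣0ᵐ⇒ones≡0 (true ∷ b) d with d zero
  ... | ()
  boolExp∣0ᵐ⇒ones≡0 (false ∷ b) d = boolExp∣0ᵐ⇒ones≡0 b (λ i → d (suc i))

  boolExp∣singleExp⇒ones≤1 : ∀ {k} (b : Vec Bool k) c n → boolExp b ∣ᵐ singleExp c n → ones b ℕ.≤ 1
  boolExp∣singleExp⇒ones≤1 (true ∷ b) zero n d = s≤s (NP.≤-reflexive (boolExp∣0ᵐ⇒ones≡0 b (λ i → d (suc i))))
  boolExp∣singleExp⇒ones≤1 (false ∷ b) zero n d = NP.≤-trans (NP.≤-reflexive (boolExp∣0ᵐ⇒ones≡0 b (λ i → d (suc i)))) z≤n
  boolExp∣singleExp⇒ones≤1 (true ∷ b) (suc c) n d with d zero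
  ... | ()
  boolExp∣singleExp⇒ones≤1 (false ∷ b) (suc c) n d = boolExp∣singleExp⇒ones≤1 b c n (λ i → d (suc i))

  ones-mono : ∀ {k} (b b' : Vec Bool k) → boolExp b ∣ᵐ boolExp b' → ones b ℕ.≤ ones b'
  ones-mono [] [] d = z≤n
  ones-mono (true ∷ b) (true ∷ b') d = s≤s (ones-mono b b' (λ i → d (suc i)))
  ones-mono (false ∷ b) (true ∷ b') d = NP.m≤n⇒m≤1+n (ones-mono b b' (λ i → d (suc i)))
  ones-mono (false ∷ b) (false ∷ b') d = ones-mono b b' (λ i → d (suc i))
  ones-mono (true ∷ b) (false ∷ b') d with d zero
  ... | ()

  boolExp-∣-sameOnes⇒≡ : ∀ {k} (b b' : Vec Bool k) → boolExp b ∣ᵐ boolExp b' → ones b ≡ ones b' → b ≡ b'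
  boolExp-∣-sameOnes⇒≡ [] [] d e = ≡.refl
  boolExp-∣-sameOnes⇒≡ (true ∷ b) (true ∷ b') d e = ≡.cong (true ∷_) (boolExp-∣-sameOnes⇒≡ b b' (λ i → d (suc i)) (NP.suc-injective e))
  boolExp-∣-sameOnes⇒≡ (false ∷ b) (false ∷ b') d e = ≡.cong (false ∷_) (boolExp-∣-sameOnes⇒≡ b b' (λ i → d (suc i)) e)
  boolExp-∣-sameOnes⇒≡ (false ∷ b) (true ∷ b') d e = ⊥-elim (NP.<⇒≱ (NP.≤-reflexive (≡.sym e)) (ones-mono b b' (λ i → d (suc i))))
  boolExp-∣-sameOnes⇒≡ (true ∷ b) (false ∷ b') d e with d zero
  ... | ()

  singleExp-∣ : ∀ {k} (a : Fin k) n (β : Mon k) → n ℕ.≤ lookup β a → singleExp a n ∣ᵐ β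
  singleExp-∣ a n β le j with a FinP.≟ j
  ... | yes ≡.refl = ≡.subst (ℕ._≤ lookup β a) (≡.sym (singleExp-at a n)) le
  ... | no ne = ≡.subst (ℕ._≤ lookup β j) (≡.sym (singleExp-elsewhere a j n ne)) z≤n

  unitExp≢qExp : ∀ a → unitExp a ≢ qExp a
  unitExp≢qExp a e = NP.<⇒≢ (NP.<-≤-trans (s≤s (s≤s z≤n)) 2≤q) (≡.trans (≡.sym (singleExp-at a 1)) (≡.trans (≡.cong (λ v → lookup v a) e) (singleExp-at a q)))

  fieldEq-support : ∀ a β → ¬ coeff (fieldEq a) β ≈ 0# → (β ≡ qExp a) ⊎ (β ≡ unitExp a)
  fieldEq-support a β nz = by-cases (VecP.≡-dec ℕ._≟_ (qExp a) β) (VecP.≡-dec ℕ._≟_ (unitExp a) β)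
    where
    by-cases : Dec (qExp a ≡ β) → Dec (unitExp a ≡ β) → (β ≡ qExp a) ⊎ (β ≡ unitExp a)
    by-cases (yes e) _ = inj₁ (≡.sym e)
    by-cases (no _) (yes e) = inj₂ (≡.sym e)
    by-cases (no n1) (no n2) = ⊥-elim (nz (trans (coeff-pair 1# (- 1#) (qExp a) (unitExp a) β) (trans (+-cong (coeffTerm-other 1# (qExp a) β n1) (coeffTerm-other (- 1#) (unitExp a) β n2)) (+-identityˡ 0#))))

  monomial-support : ∀ α β → ¬ coeff ((1# , α) ∷ []) β ≈ 0# → β ≡ α
  monomial-support α β β≉0 = by-cases (VecP.≡-dec ℕ._≟_ α β)
    where
    by-cases : Dec (α ≡ β) → β ≡ α
    by-cases (yes α≡β) = ≡.sym α≡β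
    by-cases (no α≢β) = ⊥-elim (β≉0 (coeffTerm-other 1# α β α≢β))

  fieldEq-headed : ∀ a → Headed (fieldEq a) (qExp a)
  fieldEq-headed a = trans (coeff-pair 1# (- 1#) (qExp a) (unitExp a) (qExp a)) (trans (+-cong (coeffTerm-same 1# (qExp a)) (coeffTerm-other _ _ _ (unitExp≢qExp a))) (+-identityʳ 1#)) ,
            λ β nz → case (fieldEq-support a β nz)
    where
    case : ∀ {β} → (β ≡ qExp a) ⊎ (β ≡ unitExp a) → β ∣ᵐ qExp a
    case (inj₁ ≡.refl) = ∣-refl (qExp a)
    case (inj₂ ≡.refl) = singleExp-∣ a 1 (qExp a) (≡.subst (1 ℕ.≤_) (≡.sym (singleExp-at a q)) (NP.≤-trans (s≤s z≤n) 2≤q))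

  monomial-headed : ∀ α → Headed ((1# , α) ∷ []) α
  monomial-headed α = coeffTerm-same 1# α , λ β nz → ≡.subst (_∣ᵐ α) (≡.sym (monomial-support α β nz)) (∣-refl α)

  fieldEq-LM : ∀ a α → Headed (fieldEq a) α → α ≡ qExp a
  fieldEq-LM a α headed = LM-unique (fieldEq a) α (qExp a) (Headed⇒LM (fieldEq a) α headed)
                            (Headed⇒LM (fieldEq a) (qExp a) (fieldEq-headed a))

  monomial-LM : ∀ γ α → Headed ((1# , γ) ∷ []) α → α ≡ γ
  monomial-LM γ α headed = LM-unique ((1# , γ) ∷ []) α γ (Headed⇒LM ((1# , γ) ∷ []) α headed)
                             (Headed⇒LM ((1# , γ) ∷ []) γ (monomial-headed γ))

  allBools-complete : ∀ {k} (b : Vec Bool k) → b ∈ allBools k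
  allBools-complete [] = here ≡.refl
  allBools-complete {suc k} (x ∷ b) = ∈-concatMap⁺ (λ v → (true ∷ v) ∷ (false ∷ v) ∷ []) (Any.map (λ { ≡.refl → here-or-next x }) (allBools-complete b))
    where
    here-or-next : ∀ x → (x ∷ b) ∈ ((true ∷ b) ∷ (false ∷ b) ∷ [])
    here-or-next true = here ≡.refl
    here-or-next false = there (here ≡.refl)

  allBools-unique : ∀ k → Unique (allBools k)
  allBools-unique zero = [] ∷ []
  allBools-unique (suc k) = UP.concat⁺ (All-map (allBools k)) (APP.map⁺ (AllPairs.map disj (allBools-unique k)))
    where
    fb : Vec Bool k → List (Vec Bool (suc k))
    fb v = (true ∷ v) ∷ (false ∷ v) ∷ []
    All-map : ∀ L → All Unique (List.map fb L)
    All-map [] = []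
    All-map (v ∷ L) = (((λ ()) ∷ []) ∷ [] ∷ []) ∷ All-map L
    tl : ∀ {u v} → u ∈ fb v → Vec.tail u ≡ v
    tl (here ≡.refl) = ≡.refl
    tl (there (here ≡.refl)) = ≡.refl
    disj : ∀ {v w} → v ≢ w → (∀ {u} → ¬ (u ∈ fb v × u ∈ fb w))
    disj ne (p , p') = ne (≡.trans (≡.sym (tl p)) (tl p'))

  monomial∈Mms : ∀ s (b : Vec Bool m) → ones b ≡ s → ((1# , boolExp b) ∷ []) ∈ Mms s
  monomial∈Mms s b e = ∈-map⁺ _ (∈-map⁺ _ (∈-filter⁺ (λ b → ones b ℕ.≟ s) (allBools-complete b) e))

  Mms-members : ∀ s g → g ∈ Mms s → ∃[ b ] (ones b ≡ s × g ≡ ((1# , boolExp b) ∷ []))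
  Mms-members s g p with ∈-map⁻ _ p
  ... | α , pα , ≡.refl with ∈-map⁻ _ pα
  ...   | b , pb , ≡.refl = b , proj₂ (∈-filter⁻ (λ b → ones b ℕ.≟ s) {v = b} {xs = allBools m} pb) , ≡.refl

  Eq-members : ∀ g → g ∈ Eq → ∃[ a ] (g ≡ fieldEq a)
  Eq-members g p with ∈-map⁻ _ p
  ... | a , _ , ≡.refl = a , ≡.refl

  vars-members : ∀ g → g ∈ vars → ∃[ a ] (g ≡ var a)
  vars-members g p with ∈-map⁻ _ p
  ... | a , _ , ≡.refl = a , ≡.refl

  choose-subSupport : ∀ {k} (β : Mon k) s → s ℕ.≤ supp β → ∃[ b ] (ones b ≡ s × boolExp b ∣ᵐ β)
  choose-subSupport [] zero _ = [] , ≡.refl , (λ ())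
  choose-subSupport (e ∷ β) zero _ with choose-subSupport β zero z≤n
  ... | b , c , d = false ∷ b , c , λ { zero → z≤n ; (suc i) → d i }
  choose-subSupport (zero ∷ β) (suc s) le with choose-subSupport β (suc s) le
  ... | b , c , d = false ∷ b , c , λ { zero → z≤n ; (suc i) → d i }
  choose-subSupport (suc e ∷ β) (suc s) (s≤s le) with choose-subSupport β s le
  ... | b , c , d = true ∷ b , ≡.cong suc c , λ { zero → s≤s z≤n ; (suc i) → d i }

  eval-monomial : ∀ α x → eval ((1# , α) ∷ []) x ≈ monValue x α
  eval-monomial α x = trans (eval-cons 1# α [] x) (trans (+-identityʳ _) (*-identityˡ _))

  fieldEq≢monomial : ∀ a α → fieldEq a ≢ ((1# , α) ∷ [])
  fieldEq≢monomial a α e with ≡.cong length e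
  ... | ()

  headExp : Poly → Mon m
  headExp [] = 0ᵐ
  headExp ((d , α) ∷ _) = α

  fieldEq-injective : ∀ {a c} → fieldEq a ≡ fieldEq c → a ≡ c
  fieldEq-injective {a} {c} e = singleExp-∣-injective a c q (NP.≤-trans (s≤s z≤n) 2≤q) (≡.subst (qExp a ∣ᵐ_) (≡.cong headExp e) (∣-refl (qExp a)))

  monomial-injective : ∀ {α β : Mon m} → ((1# , α) ∷ []) ≡ ((1# , β) ∷ []) → α ≡ β
  monomial-injective e = ≡.cong headExp e

  boolExp-injective : ∀ {k} {b b' : Vec Bool k} → boolExp b ≡ boolExp b' → b ≡ b'
  boolExp-injective {b = []} {[]} e = ≡.refl
  boolExp-injective {b = true ∷ b} {true ∷ b'} e = ≡.cong (true ∷_) (boolExp-injective (proj₂ (VecP.∷-injective e)))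
  boolExp-injective {b = false ∷ b} {false ∷ b'} e = ≡.cong (false ∷_) (boolExp-injective (proj₂ (VecP.∷-injective e)))
  boolExp-injective {b = true ∷ b} {false ∷ b'} e with proj₁ (VecP.∷-injective e)
  ... | ()
  boolExp-injective {b = false ∷ b} {true ∷ b'} e with proj₁ (VecP.∷-injective e)
  ... | ()


-- The divisibility condition
-- comes from the leading-monomial lemma: the leading monomial β of f ∈ I(Q_t)
-- has an exponent ≥ q (divisible by some yᵢ^q) or involves more than t variables
-- (divisible by a squarefree monomial of degree t + 1).
module GroebnerBases {q : ℕ} (F : FiniteField q) (m : ℕ) (ord : TermOrder m) where
  open GroebnerCandidates F m ord public

  module BasisForPositiveT (t : ℕ) (1≤t : 1 ℕ.≤ t) where
    G : List Poly
    G = Eq ++ Mms (suc t)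

    G⊆ideal : ∀ g → g ∈ G → InVanishingIdealQ t g
    G⊆ideal g g∈G x wt≤t with ∈-++⁻ Eq g∈G
    ... | inj₁ g∈E with Eq-members g g∈E
    ...   | a , ≡.refl = fieldEq-vanishes a x
    G⊆ideal g g∈G x wt≤t | inj₂ g∈M with Mms-members (suc t) g g∈M
    ...   | b , ones≡ , ≡.refl = trans (eval-monomial (boolExp b) x) (monValue≈0-if-wt<supp x (boolExp b)
                                   (≡.subst (wt x ℕ.<_) (≡.sym (≡.trans (supp-boolExp b) ones≡)) (s≤s wt≤t)))

    G-headed : ∀ g → g ∈ G → ∃[ α ] Headed g α
    G-headed g g∈G with ∈-++⁻ Eq g∈G
    ... | inj₁ g∈E with Eq-members g g∈E
    ...   | a , ≡.refl = qExp a , fieldEq-headed a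
    G-headed g g∈G | inj₂ g∈M with Mms-members (suc t) g g∈M
    ...   | b , _ , ≡.refl = boolExp b , monomial-headed (boolExp b)

    G-unique : Unique G
    G-unique = UP.++⁺ (UP.map⁺ fieldEq-injective (UP.allFin⁺ m))
                      (UP.map⁺ monomial-injective (UP.map⁺ boolExp-injective
                        (UP.filter⁺ (λ b → ones b ℕ.≟ suc t) (allBools-unique m))))
                      disjoint
      where
      disjoint : ∀ {v} → ¬ (v ∈ Eq × v ∈ Mms (suc t))
      disjoint (v∈E , v∈M) with Eq-members _ v∈E | Mms-members (suc t) _ v∈M
      ... | a , v≡ | b , _ , v≡′ = fieldEq≢monomial a (boolExp b) (≡.trans (≡.sym v≡) v≡′)

    G-reduced : ∀ g h → g ∈ G → h ∈ G → ∀ α → Headed g α → ∀ β → ¬ coeff h β ≈ 0# → α ∣ᵐ β → g ≡ h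
    G-reduced g h g∈G h∈G α headed β β≉0 α∣β with ∈-++⁻ Eq g∈G | ∈-++⁻ Eq h∈G
    -- yₐ^q divides only yₐ^q among the monomials of E_q[Y]
    ... | inj₁ g∈E | inj₁ h∈E with Eq-members g g∈E | Eq-members h h∈E
    ...   | a , ≡.refl | c , ≡.refl with fieldEq-LM a α headed | fieldEq-support c β β≉0
    ...     | ≡.refl | inj₁ ≡.refl = ≡.cong fieldEq (singleExp-∣-injective a c q (NP.≤-trans (s≤s z≤n) 2≤q) α∣β)
    ...     | ≡.refl | inj₂ ≡.refl = ⊥-elim (qExp∤unitExp a c α∣β)
    -- yₐ^q divides no squarefree monomial
    G-reduced g h g∈G h∈G α headed β β≉0 α∣β | inj₁ g∈E | inj₂ h∈M with Eq-members g g∈E | Mms-members (suc t) h h∈M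
    ...   | a , ≡.refl | b , _ , ≡.refl with fieldEq-LM a α headed | monomial-support (boolExp b) β β≉0
    ...     | ≡.refl | ≡.refl = ⊥-elim (qExp∤boolExp a b α∣β)
    -- a squarefree monomial of degree t + 1 ≥ 2 divides no monomial of E_q[Y]
    G-reduced g h g∈G h∈G α headed β β≉0 α∣β | inj₂ g∈M | inj₁ h∈E with Mms-members (suc t) g g∈M | Eq-members h h∈E
    ...   | b , ones≡ , ≡.refl | a , ≡.refl with monomial-LM (boolExp b) α headed | fieldEq-support a β β≉0
    ...     | ≡.refl | inj₁ ≡.refl = ⊥-elim (NP.<⇒≱ (s≤s 1≤t) (≡.subst (ℕ._≤ 1) ones≡ (boolExp∣singleExp⇒ones≤1 b a q α∣β)))
    ...     | ≡.refl | inj₂ ≡.refl = ⊥-elim (NP.<⇒≱ (s≤s 1≤t) (≡.subst (ℕ._≤ 1) ones≡ (boolExp∣singleExp⇒ones≤1 b a 1 α∣β)))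
    -- squarefree monomials of the same degree divide each other only if equal
    G-reduced g h g∈G h∈G α headed β β≉0 α∣β | inj₂ g∈M | inj₂ h∈M with Mms-members (suc t) g g∈M | Mms-members (suc t) h h∈M
    ...   | b , ones≡ , ≡.refl | b' , ones≡′ , ≡.refl with monomial-LM (boolExp b) α headed | monomial-support (boolExp b') β β≉0
    ...     | ≡.refl | ≡.refl = ≡.cong (λ z → (1# , boolExp z) ∷ []) (boolExp-∣-sameOnes⇒≡ b b' α∣β (≡.trans ones≡ (≡.sym ones≡′)))

    G-divides-LM : ∀ f → InVanishingIdealQ t f → ∀ β → IsLM ord f β → ∃[ g ] (g ∈ G × ∃[ α ] (Headed g α × α ∣ᵐ β))
    G-divides-LM f f∈I β lm with FinP.any? (λ i → q ℕ.≤? lookup β i)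
    ... | yes (i , q≤βᵢ) = fieldEq i , ∈-++⁺ˡ (fieldEq∈Eq i) , qExp i , fieldEq-headed i , singleExp-∣ i q β q≤βᵢ
    ... | no standard with supp β ℕ.≤? t
    ...   | yes low = ⊥-elim (no-standard-lowSupport-LM t ord f β f∈I lm
                                (¬q≤⇒Standard β (λ i q≤βᵢ → standard (i , q≤βᵢ))) low)
    ...   | no high with choose-subSupport β (suc t) (NP.≰⇒> high)
    ...     | b , ones≡ , b∣β = _ , ∈-++⁺ʳ Eq (monomial∈Mms (suc t) b ones≡) , boolExp b , monomial-headed (boolExp b) , b∣β

    isReducedGB : IsReducedGB ord (InVanishingIdealQ t) G
    isReducedGB = reducedGB-criterion (InVanishingIdealQ t) G G⊆ideal G-headed G-unique G-reduced G-divides-LM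

  module BasisForZeroT where
    G : List Poly
    G = vars

    wt≤0⇒coordinate≈0 : ∀ {k} (x : Vec Carrier k) i → wt x ℕ.≤ 0 → lookup x i ≈ 0#
    wt≤0⇒coordinate≈0 (a ∷ x) i wt≤0 with a ≟ 0#
    wt≤0⇒coordinate≈0 (a ∷ x) zero wt≤0 | yes a≈0 = a≈0
    wt≤0⇒coordinate≈0 (a ∷ x) (suc i) wt≤0 | yes _ = wt≤0⇒coordinate≈0 x i wt≤0
    wt≤0⇒coordinate≈0 (a ∷ x) i () | no _

    G⊆ideal : ∀ g → g ∈ G → InVanishingIdealQ 0 g
    G⊆ideal g g∈G x wt≤0 with vars-members g g∈G
    ... | a , ≡.refl = trans (eval-var a x) (wt≤0⇒coordinate≈0 x a wt≤0)

    G-headed : ∀ g → g ∈ G → ∃[ α ] Headed g α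
    G-headed g g∈G with vars-members g g∈G
    ... | a , ≡.refl = unitExp a , monomial-headed (unitExp a)

    var-injective : ∀ {a c} → var a ≡ var c → a ≡ c
    var-injective {a} {c} e = singleExp-∣-injective a c 1 (s≤s z≤n)
                                (≡.subst (unitExp a ∣ᵐ_) (monomial-injective e) (∣-refl (unitExp a)))

    G-unique : Unique G
    G-unique = UP.map⁺ var-injective (UP.allFin⁺ m)

    G-reduced : ∀ g h → g ∈ G → h ∈ G → ∀ α → Headed g α → ∀ β → ¬ coeff h β ≈ 0# → α ∣ᵐ β → g ≡ h
    G-reduced g h g∈G h∈G α headed β β≉0 α∣β with vars-members g g∈G | vars-members h h∈G
    ... | a , ≡.refl | c , ≡.refl with monomial-LM (unitExp a) α headed | monomial-support (unitExp c) β β≉0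
    ...   | ≡.refl | ≡.refl = ≡.cong var (singleExp-∣-injective a c 1 (s≤s z≤n) α∣β)

    allExponentsZero⇒supp≤0 : ∀ {k} (β : Mon k) → (∀ i → ¬ 1 ℕ.≤ lookup β i) → supp β ℕ.≤ 0
    allExponentsZero⇒supp≤0 [] _ = z≤n
    allExponentsZero⇒supp≤0 (zero ∷ β) zeros = allExponentsZero⇒supp≤0 β (λ i → zeros (suc i))
    allExponentsZero⇒supp≤0 (suc e ∷ β) zeros = ⊥-elim (zeros zero (s≤s z≤n))

    G-divides-LM : ∀ f → InVanishingIdealQ 0 f → ∀ β → IsLM ord f β → ∃[ g ] (g ∈ G × ∃[ α ] (Headed g α × α ∣ᵐ β))
    G-divides-LM f f∈I β lm with FinP.any? (λ i → 1 ℕ.≤? lookup β i)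
    ... | yes (i , 1≤βᵢ) = var i , ∈-map⁺ var (∈-allFin i) , unitExp i , monomial-headed (unitExp i) , singleExp-∣ i 1 β 1≤βᵢ
    ... | no zeros = ⊥-elim (no-standard-lowSupport-LM 0 ord f β f∈I lm standard
                                (allExponentsZero⇒supp≤0 β (λ i 1≤βᵢ → zeros (i , 1≤βᵢ))))
      where
      standard : Standard β
      standard i with lookup β i in eq
      ... | zero = NP.≤-trans (s≤s z≤n) 2≤q
      ... | suc e = ⊥-elim (zeros (i , ≡.subst (1 ℕ.≤_) (≡.sym eq) (s≤s z≤n)))

    isReducedGB : IsReducedGB ord (InVanishingIdealQ 0) G
    isReducedGB = reducedGB-criterion (InVanishingIdealQ 0) G G⊆ideal G-headed G-unique G-reduced G-divides-LM


open import Data.Nat using (_≤_; _<_)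

-- The theorem: part one is the ideal equality, part two the two Gröbner bases.
mainTheorem3 : ∀ {q : ℕ} (F : FiniteField q) → IsPrimePower q →
    ∀ (m t : ℕ) → 1 ≤ m → t < m →
    let open Polynomials F m in
    (∀ f → InVanishingIdealQ t f ⇔ (f ∈⟨ sigmasFrom t ++ Eq ⟩))
    × (∀ (ord : TermOrder m) →
    (1 ≤ t → IsReducedGB ord (InVanishingIdealQ t) (Eq ++ Mms (suc t)))
    × (t ≡ 0 → IsReducedGB ord (InVanishingIdealQ t) vars))
mainTheorem3 F _ m t _ _ =
  VanishingIdealGenerators.vanishing⇔ideal F m t ,
  λ ord → (λ 1≤t → GroebnerBases.BasisForPositiveT.isReducedGB F m ord t 1≤t)
        , (λ { ≡.refl → GroebnerBases.BasisForZeroT.isReducedGB F m ord })
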